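{- Let $q$ be a power of a prime $p$. Let $a,d,s$ be positive integers such that $L=\{a,a+d,\ldots,a+(s-1)d\}\subseteq[q-1]$. Let $\mathcal{F}\subseteq 2^{[n]}$ be a $q$-modular $L$-differencing Sperner system. If $$\sum_{\ell\in L}v_p(\ell)<\max\{(s-1)v_p(d)+v_p(q),\ s\,v_p(d)+v_p(s!)+1\},$$ then $$|\mathcal{F}|\le\sum_{i=0}^{s}\binom{n}{i}.$$
   Context: $n$ is a positive integer, $[n]=\{1,\ldots,n\}$, $[q-1]=\{1,\ldots,q-1\}$, and $2^{[n]}$ is the family of all subsets of $[n]$. For a prime $p$ and an integer $m$, $v_p(m)$ is the largest non-negative integer $k$ with $p^k\mid m$ ($v_p(0)=+\infty$). For $L\subseteq[q-1]$, a family $\mathcal{F}\subseteq 2^{[n]}$ is $q$-modular $L$-differencing Sperner if for any distinct $A,B\in\mathcal{F}$ there is $\ell\in L$ with $|A\setminus B|\equiv\ell\pmod q$. -}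

module Defs where

open import Data.Nat using (ℕ; zero; suc; _+_; _*_; _/_)
open import Data.Nat.Divisibility using (_∣?_)
open import Relation.Nullary using (yes; no)

-- p-adic valuation v_p(m) for m ≥ 1 and prime p: the largest k with p^k ∣ m.
-- Computed by repeated division; the fuel m suffices since each division by
-- p ≥ 2 shrinks m.  (Value at m = 0 or p < 2 is 0; never used in the theorem,
-- where all arguments are positive and p is prime.)
vAux : ℕ → ℕ → ℕ → ℕ
vAux zero p m = 0
vAux (suc f) zero m = 0
vAux (suc f) (suc zero) m = 0
vAux (suc f) (suc (suc k)) zero = 0
vAux (suc f) (suc (suc k)) (suc m) with suc (suc k) ∣? suc m
... | yes _ = suc (vAux f (suc (suc k)) (suc m / suc (suc k)))
... | no  _ = 0

v : ℕ → ℕ → ℕ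
v p m = vAux m p m

module Submission where

-- For A ∈ F let f_A(x) = ∏_{j<s} (|A ∖ x| − ℓ_j) with ℓ_j = a + j d: a function on the cube {0,1}ⁿ
-- of degree ≤ s, and V = Σ_j v_p(ℓ_j). For B ≠ A in F we have |A ∖ B| ≡ ℓ_i (mod q = p^k) for some i,
-- and the valuation hypothesis is exactly what makes p^(1+V) divide f_A(B): either every factor is
-- divisible by p^(v_p(d)) and the i-th one by q, or, after dividing every factor by p^(v_p(d)), what
-- remains is a product of s terms of an arithmetic progression with difference prime to p; multiplying
-- by an inverse of the difference modulo a high power of p turns it into s!·C(m+s, s) for some m, and a
-- Lucas-type argument shows p ∣ C(m+s, s). On the diagonal, f_A(A) = ±∏ ℓ_j has valuation exactly V.
-- If |F| exceeded the number Σ_{i≤s} C(n,i) of monomials of degree ≤ s, Gaussian elimination over ℤ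
-- would give an integer vector z, not divisible by p, orthogonal to every monomial evaluated on F;
-- then 0 = Σ_B f_A(B) z_B ≡ f_A(A) z_A (mod p^(1+V)) for an A with p ∤ z_A, a contradiction.

open import Defs
open import Data.Nat using (ℕ; NonZero)
open import Data.Nat.Primality using (Prime)

module BigOperators where

  open import Data.Nat using (ℕ; zero; suc; _+_; _*_; _≤_; _<_; z≤n; s≤s)
  open import Data.Nat.Properties
  open import Data.List using (map; upTo; applyUpTo)
  open import Data.Nat.ListAction using (sum)
  open import Function using (_∘_)
  open import Relation.Binary.PropositionalEquality

  ∑ ∏ : ℕ → (ℕ → ℕ) → ℕ
  ∑ zero    f = 0
  ∑ (suc s) f = f 0 + ∑ s (f ∘ suc)
  ∏ zero    f = 1
  ∏ (suc s) f = f 0 * ∏ s (f ∘ suc)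

  syntax ∑ s (λ j → e) = ∑[ j < s ] e
  syntax ∏ s (λ j → e) = ∏[ j < s ] e

  sum-map-applyUpTo : ∀ s (f g : ℕ → ℕ) → sum (map f (applyUpTo g s)) ≡ ∑[ j < s ] f (g j)
  sum-map-applyUpTo zero    f g = refl
  sum-map-applyUpTo (suc s) f g = cong (f (g 0) +_) (sum-map-applyUpTo s f (g ∘ suc))

  sum-map-upTo : ∀ s (f : ℕ → ℕ) → sum (map f (upTo s)) ≡ ∑[ j < s ] f j
  sum-map-upTo s f = sum-map-applyUpTo s f (λ j → j)

  ∑-cong : ∀ s {f g} → (∀ j → f j ≡ g j) → ∑ s f ≡ ∑ s g
  ∑-cong zero    f≡g = refl
  ∑-cong (suc s) f≡g = cong₂ _+_ (f≡g 0) (∑-cong s (f≡g ∘ suc))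

  ∏-cong : ∀ s {f g} → (∀ j → f j ≡ g j) → ∏ s f ≡ ∏ s g
  ∏-cong zero    f≡g = refl
  ∏-cong (suc s) f≡g = cong₂ _*_ (f≡g 0) (∏-cong s (f≡g ∘ suc))

  ∑-+ : ∀ s f g → ∑[ j < s ] (f j + g j) ≡ ∑ s f + ∑ s g
  ∑-+ zero    f g = refl
  ∑-+ (suc s) f g = trans (cong (f 0 + g 0 +_) (∑-+ s (f ∘ suc) (g ∘ suc)))
                          (interchange (f 0) (g 0) (∑ s (f ∘ suc)) (∑ s (g ∘ suc)))
    where open import Algebra.Properties.CommutativeSemigroup +-commutativeSemigroup using (interchange)

  ∑-bound : ∀ s f e → (∀ j → j < s → f j < e) → ∑ s f + s ≤ s * e
  ∑-bound zero    f e _    = z≤n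
  ∑-bound (suc s) f e f<e =
    subst (_≤ e + s * e) (sym (trans (+-suc (f 0 + ∑ s (f ∘ suc)) s) (cong suc (+-assoc (f 0) _ s))))
      (+-mono-≤ (f<e 0 (s≤s z≤n)) (∑-bound s (f ∘ suc) e λ j j<s → f<e (suc j) (s≤s j<s)))

  ∏-snoc : ∀ s f → ∏ (suc s) f ≡ ∏ s f * f s
  ∏-snoc zero    f = trans (*-identityʳ (f 0)) (sym (*-identityˡ (f 0)))
  ∏-snoc (suc s) f = trans (cong (f 0 *_) (∏-snoc s (f ∘ suc))) (sym (*-assoc (f 0) _ _))

module Valuation where

  open import Data.Nat
  open import Data.Nat.Properties
  open import Data.Nat.Divisibility
  open import Data.Nat.DivMod using (_/_; m*[n/m]≡n; m/n<m)
  open import Data.Nat.Primality using (Prime; prime⇒nonZero; prime⇒nonTrivial; euclidsLemma)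
  open import Data.Nat.Solver using (module +-*-Solver)
  open import Data.Product using (∃-syntax; _×_; _,_)
  open import Data.Sum using (inj₁; inj₂)
  open import Function using (_∘_)
  open import Relation.Nullary using (¬_; yes; no; contradiction)
  open import Relation.Binary.PropositionalEquality
  open +-*-Solver
  open BigOperators

  p^v[m]∣m : ∀ p m → p ^ v p m ∣ m
  p^v[m]∣m p m = go m p m
    where
    go : ∀ f p m → p ^ vAux f p m ∣ m
    go zero                p             m       = 1∣ m
    go (suc f)             zero          m       = 1∣ m
    go (suc f)             (suc zero)    m       = 1∣ m
    go (suc f)             (suc (suc k)) zero    = 1∣ 0
    go (suc f) p@(suc (suc k)) (suc m) with p ∣? suc m
    ... | no  _   = 1∣ suc m
    ... | yes p∣m = subst (p * p ^ vAux f p (suc m / p) ∣_) (m*[n/m]≡n p∣m)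
                      (*-monoʳ-∣ p (go f p (suc m / p)))

  p^[1+v[m]]∤m : ∀ {p m} → 1 < p → .{{NonZero m}} → ¬ p ^ suc (v p m) ∣ m
  p^[1+v[m]]∤m {p} {m} 1<p = go m 1<p (>-nonZero⁻¹ m) ≤-refl
    where
    go : ∀ f {p m} → 1 < p → 0 < m → m ≤ f → ¬ p ^ suc (vAux f p m) ∣ m
    go zero {m = suc _} _ _ ()
    go (suc f) {p@(suc (suc k))} {suc m} (s≤s (s≤s z≤n)) _ m<1+f p^∣m with p ∣? suc m
    ... | no  p∤m = p∤m (∣-trans (∣-reflexive (sym (*-identityʳ p))) p^∣m)
    ... | yes p∣m = go f (s≤s (s≤s z≤n)) quotient>0 quotient≤f
                      (*-cancelˡ-∣ p (subst (p * p ^ suc (vAux f p (suc m / p)) ∣_) (sym (m*[n/m]≡n p∣m)) p^∣m))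
      where
      quotient>0 : 0 < suc m / p
      quotient>0 = n≢0⇒n>0 λ q≡0 → 0≢1+n (trans (sym (trans (cong (p *_) q≡0) (*-zeroʳ p))) (m*[n/m]≡n p∣m))
      quotient≤f : suc m / p ≤ f
      quotient≤f = ≤-pred (≤-trans (m/n<m (suc m) p (s≤s (s≤s z≤n))) m<1+f)

  valuation-split : ∀ {p m} → 1 < p → .{{NonZero m}} → ∃[ u ] m ≡ p ^ v p m * u × ¬ p ∣ u
  valuation-split {p} {m} 1<p with p^v[m]∣m p m
  ... | divides u m≡u*p^v = u , trans m≡u*p^v (*-comm u _) , p∤u
    where
    p∤u : ¬ p ∣ u
    p∤u p∣u = p^[1+v[m]]∤m 1<p (subst (_∣ m) (*-comm (p ^ v p m) p)
                (subst (p ^ v p m * p ∣_) (sym (trans m≡u*p^v (*-comm u _))) (*-monoʳ-∣ (p ^ v p m) p∣u)))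

  p^m∣p^n : ∀ p {m n} → m ≤ n → p ^ m ∣ p ^ n
  p^m∣p^n p {m} {n} m≤n = divides (p ^ (n ∸ m)) (begin
    p ^ n               ≡⟨ cong (p ^_) (sym (m+[n∸m]≡n m≤n)) ⟩
    p ^ (m + (n ∸ m))   ≡⟨ ^-distribˡ-+-* p m (n ∸ m) ⟩
    p ^ m * p ^ (n ∸ m) ≡⟨ *-comm (p ^ m) _ ⟩
    p ^ (n ∸ m) * p ^ m ∎)
    where open ≡-Reasoning

  p^e∤x⇒v<e : ∀ {p x} e .{{_ : NonZero p}} → ¬ p ^ e ∣ x → v p x < e
  p^e∤x⇒v<e {p} {x} e p^e∤x = ≰⇒> λ e≤v → p^e∤x (∣-trans (p^m∣p^n p e≤v) (p^v[m]∣m p x))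

  x<p^k⇒v<k : ∀ {p x} k .{{_ : NonZero p}} → .{{NonZero x}} → x < p ^ k → v p x < k
  x<p^k⇒v<k {p} {x} k x<p^k = ≰⇒> λ k≤v → <⇒≱ x<p^k (≤-trans (^-monoʳ-≤ p k≤v) (∣⇒≤ (p^v[m]∣m p x)))

  module _ {p} (prime : Prime p) where

    private instance _ = prime⇒nonZero prime
    1<p : 1 < p
    1<p = nonTrivial⇒n>1 p {{prime⇒nonTrivial prime}}

    product-split : ∀ s (f : ℕ → ℕ) → (∀ j → NonZero (f j)) →
                    ∃[ u ] ∏[ j < s ] f j ≡ p ^ (∑[ j < s ] v p (f j)) * u × ¬ p ∣ u
    product-split zero    f f≢0 = 1 , refl , λ p∣1 → <⇒≢ 1<p (sym (∣1⇒≡1 p∣1))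
    product-split (suc s) f f≢0
      with valuation-split {m = f 0} 1<p {{f≢0 0}} | product-split s (f ∘ suc) (f≢0 ∘ suc)
    ... | u , f0≡ , p∤u | U , ∏≡ , p∤U = u * U , eq , p∤uU
      where
      e = v p (f 0)
      E = ∑[ j < s ] v p (f (suc j))
      eq : f 0 * ∏[ j < s ] f (suc j) ≡ p ^ (e + E) * (u * U)
      eq = begin
        f 0 * ∏[ j < s ] f (suc j)     ≡⟨ cong₂ _*_ f0≡ ∏≡ ⟩
        p ^ e * u * (p ^ E * U)        ≡⟨ solve 4 (λ a b c d → a :* b :* (c :* d) := a :* c :* (b :* d)) refl (p ^ e) u (p ^ E) U ⟩
        p ^ e * p ^ E * (u * U)        ≡⟨ cong (_* (u * U)) (sym (^-distribˡ-+-* p e E)) ⟩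
        p ^ (e + E) * (u * U)          ∎
        where open ≡-Reasoning
      p∤uU : ¬ p ∣ u * U
      p∤uU p∣uU with euclidsLemma u U prime p∣uU
      ... | inj₁ p∣u = p∤u p∣u
      ... | inj₂ p∣U = p∤U p∣U

    p^[1+∑v]∤∏ : ∀ s (f : ℕ → ℕ) → (∀ j → NonZero (f j)) → ¬ p ^ suc (∑[ j < s ] v p (f j)) ∣ ∏[ j < s ] f j
    p^[1+∑v]∤∏ s f f≢0 p^∣∏ with product-split s f f≢0
    ... | u , ∏≡ , p∤u = p∤u (*-cancelˡ-∣ (p ^ V) {{m^n≢0 p V}}
                           (subst₂ _∣_ (*-comm p (p ^ V)) ∏≡ p^∣∏))
      where V = ∑[ j < s ] v p (f j)

    p^n∣x*y⇒p^n∣x : ∀ {x y} n → ¬ p ∣ y → p ^ n ∣ x * y → p ^ n ∣ x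
    p^n∣x*y⇒p^n∣x {x} zero p∤y _ = 1∣ x
    p^n∣x*y⇒p^n∣x {x} {y} (suc n) p∤y p^n∣xy
      with euclidsLemma x y prime (∣-trans (m∣m*n (p ^ n)) p^n∣xy)
    ... | inj₂ p∣y = contradiction p∣y p∤y
    ... | inj₁ (divides x′ refl) =
      subst (p ^ suc n ∣_) (*-comm p x′) (*-monoʳ-∣ p (p^n∣x*y⇒p^n∣x n p∤y (*-cancelˡ-∣ p
        (subst (p ^ suc n ∣_) (solve 3 (λ a b c → a :* b :* c := b :* (a :* c)) refl x′ p y) p^n∣xy))))

module IntegerProducts where

  open import Data.Nat as ℕ using (ℕ; zero; suc; z≤n; s≤s; _∸_)
  import Data.Nat.Properties as ℕ
  open import Data.Integer using (ℤ; +_; -_; _+_; _-_; _*_; _^_; 0ℤ; 1ℤ; ∣_∣)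
  open import Data.Integer.Properties
  open import Data.Integer.Divisibility.Signed
  open import Data.Integer.Solver using (module +-*-Solver)
  open import Function using (_∘_)
  open import Relation.Binary.PropositionalEquality
  open +-*-Solver
  open BigOperators using (∏)

  ∏ℤ : ℕ → (ℕ → ℤ) → ℤ
  ∏ℤ zero    f = 1ℤ
  ∏ℤ (suc s) f = f 0 * ∏ℤ s (f ∘ suc)

  syntax ∏ℤ s (λ j → e) = ∏ℤ[ j < s ] e

  pos-^ : ∀ m n → + (m ℕ.^ n) ≡ (+ m) ^ n
  pos-^ m zero    = refl
  pos-^ m (suc n) = trans (pos-* m (m ℕ.^ n)) (cong (+ m *_) (pos-^ m n))

  [+p^e]^s*+p^x≡+p^[se+x] : ∀ p e s x → (+ (p ℕ.^ e)) ^ s * + (p ℕ.^ x) ≡ + (p ℕ.^ (s ℕ.* e ℕ.+ x))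
  [+p^e]^s*+p^x≡+p^[se+x] p e s x = begin
    (+ (p ℕ.^ e)) ^ s * + (p ℕ.^ x)   ≡⟨ cong (_* + (p ℕ.^ x)) (pos-^ (p ℕ.^ e) s) ⟨
    + ((p ℕ.^ e) ℕ.^ s) * + (p ℕ.^ x) ≡⟨ pos-* ((p ℕ.^ e) ℕ.^ s) (p ℕ.^ x) ⟨
    + ((p ℕ.^ e) ℕ.^ s ℕ.* p ℕ.^ x)   ≡⟨ cong (λ y → + (y ℕ.* p ℕ.^ x)) (trans (ℕ.^-*-assoc p e s) (cong (p ℕ.^_) (ℕ.*-comm e s))) ⟩
    + (p ℕ.^ (s ℕ.* e) ℕ.* p ℕ.^ x)   ≡⟨ cong +_ (ℕ.^-distribˡ-+-* p (s ℕ.* e) x) ⟨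
    + (p ℕ.^ (s ℕ.* e ℕ.+ x))         ∎
    where open ≡-Reasoning

  ∏ℤ-pos : ∀ s f → ∏ℤ[ j < s ] (+ f j) ≡ + ∏ s f
  ∏ℤ-pos zero    f = refl
  ∏ℤ-pos (suc s) f = trans (cong (+ f 0 *_) (∏ℤ-pos s (f ∘ suc))) (sym (pos-* (f 0) _))

  ∣∏ℤ∣ : ∀ s f → ∣ ∏ℤ s f ∣ ≡ ∏[ j < s ] ∣ f j ∣
  ∣∏ℤ∣ zero    f = refl
  ∣∏ℤ∣ (suc s) f = trans (abs-* (f 0) _) (cong (∣ f 0 ∣ ℕ.*_) (∣∏ℤ∣ s (f ∘ suc)))

  ∏ℤ-cong : ∀ s {f g} → (∀ j → j ℕ.< s → f j ≡ g j) → ∏ℤ s f ≡ ∏ℤ s g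
  ∏ℤ-cong zero    f≡g = refl
  ∏ℤ-cong (suc s) f≡g = cong₂ _*_ (f≡g 0 (s≤s z≤n)) (∏ℤ-cong s (λ j j<s → f≡g (suc j) (s≤s j<s)))

  ∏ℤ-scale : ∀ s x f → ∏ℤ[ j < s ] (x * f j) ≡ x ^ s * ∏ℤ s f
  ∏ℤ-scale zero    x f = refl
  ∏ℤ-scale (suc s) x f = trans (cong (x * f 0 *_) (∏ℤ-scale s x (f ∘ suc)))
    (solve 4 (λ a b c d → a :* b :* (c :* d) := a :* c :* (b :* d)) refl x (f 0) (x ^ s) (∏ℤ s (f ∘ suc)))

  ∏ℤ-congruence : ∀ s M {f g} → (∀ j → j ℕ.< s → M ∣ f j - g j) → M ∣ ∏ℤ s f - ∏ℤ s g
  ∏ℤ-congruence zero    M _   = subst (M ∣_) (sym (+-inverseʳ 1ℤ)) (divides 0ℤ (sym (*-zeroˡ M)))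
  ∏ℤ-congruence (suc s) M {f} {g} M∣f-g = subst (M ∣_) eq
    (∣m∣n⇒∣m+n (∣n⇒∣m*n (f 0) (∏ℤ-congruence s M (λ j j<s → M∣f-g (suc j) (s≤s j<s))))
               (∣m⇒∣m*n (∏ℤ s (g ∘ suc)) (M∣f-g 0 (s≤s z≤n))))
    where
    eq : f 0 * (∏ℤ s (f ∘ suc) - ∏ℤ s (g ∘ suc)) + (f 0 - g 0) * ∏ℤ s (g ∘ suc)
       ≡ f 0 * ∏ℤ s (f ∘ suc) - g 0 * ∏ℤ s (g ∘ suc)
    eq = solve 4 (λ a b c d → a :* (c :- d) :+ (a :- b) :* d := a :* c :- b :* d) refl
           (f 0) (g 0) (∏ℤ s (f ∘ suc)) (∏ℤ s (g ∘ suc))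

  *-pres-∣ : ∀ {a b m n} → a ∣ m → b ∣ n → a * b ∣ m * n
  *-pres-∣ {a} {b} (divides q refl) (divides r refl) =
    divides (q * r) (solve 4 (λ q r a b → q :* a :* (r :* b) := q :* r :* (a :* b)) refl q r a b)

  ∏ℤ-divisible : ∀ s b f → (∀ j → j ℕ.< s → b ∣ f j) → b ^ s ∣ ∏ℤ s f
  ∏ℤ-divisible zero    b f _   = ∣-refl
  ∏ℤ-divisible (suc s) b f b∣f =
    *-pres-∣ (b∣f 0 (s≤s z≤n)) (∏ℤ-divisible s b (f ∘ suc) (λ j j<s → b∣f (suc j) (s≤s j<s)))

  ∏ℤ-divisible-one : ∀ s i b c f → i ℕ.< s → (∀ j → j ℕ.< s → j ≢ i → b ∣ f j) → c ∣ f i →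
                     b ^ (s ∸ 1) * c ∣ ∏ℤ s f
  ∏ℤ-divisible-one (suc s) zero b c f _ b∣f c∣f0 =
    subst (_∣ ∏ℤ (suc s) f) (*-comm c (b ^ s))
      (*-pres-∣ c∣f0 (∏ℤ-divisible s b (f ∘ suc) (λ j j<s → b∣f (suc j) (s≤s j<s) λ ())))
  ∏ℤ-divisible-one (suc (suc s)) (suc i) b c f (s≤s i<s) b∣f c∣fi =
    subst (_∣ ∏ℤ (suc (suc s)) f) (sym (*-assoc b (b ^ s) c))
      (*-pres-∣ (b∣f 0 (s≤s z≤n) λ ())
        (∏ℤ-divisible-one (suc s) i b c (f ∘ suc) i<s
          (λ j j<s j≢i → b∣f (suc j) (s≤s j<s) (j≢i ∘ ℕ.suc-injective)) c∣fi))

module ModPrimePowers {p : ℕ} (prime : Prime p) where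

  open import Data.Nat as ℕ using (ℕ; zero; suc)
  import Data.Nat.Properties as ℕ
  import Data.Nat.Divisibility as ℕ
  open import Data.Nat.Primality using (Prime; prime⇒irreducible; euclidsLemma)
  open import Data.Nat.Coprimality using (Coprime; coprime-Bézout)
  open import Data.Nat.GCD using (module Bézout)
  open import Data.Integer using (+_; -_; _+_; _-_; _*_; _^_; 1ℤ; ∣_∣)
  open import Data.Integer.Properties
  open import Data.Integer.Divisibility.Signed
  open import Data.Integer.Solver using (module +-*-Solver)
  open import Data.Product using (∃-syntax; _,_)
  open import Data.Sum using (inj₁; inj₂)
  open import Relation.Nullary using (¬_; contradiction)
  open import Relation.Binary.PropositionalEquality
  open +-*-Solver

  p∤u⇒coprime : ∀ {u} → ¬ p ℕ.∣ u → Coprime p u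
  p∤u⇒coprime p∤u (i∣p , i∣u) with prime⇒irreducible prime i∣p
  ... | inj₁ i≡1 = i≡1
  ... | inj₂ refl = contradiction i∣u p∤u

  inverse-mod-p : ∀ {u} → ¬ p ℕ.∣ u → ∃[ g ] + p ∣ + u * g - 1ℤ
  inverse-mod-p {u} p∤u with coprime-Bézout (p∤u⇒coprime p∤u)
  ... | Bézout.+- x y eq = - + y , divides (- + x) (begin
    + u * - + y - 1ℤ       ≡⟨ solve 2 (λ u y → u :* (:- y) :- con 1ℤ := :- (con 1ℤ :+ y :* u)) refl (+ u) (+ y) ⟩
    - (1ℤ + + y * + u)     ≡⟨ cong (λ z → - (1ℤ + z)) (pos-* y u) ⟨
    - + (1 ℕ.+ y ℕ.* u)    ≡⟨ cong (λ z → - + z) eq ⟩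
    - + (x ℕ.* p)          ≡⟨ cong -_ (pos-* x p) ⟩
    - (+ x * + p)          ≡⟨ neg-distribˡ-* (+ x) (+ p) ⟩
    - + x * + p            ∎)
    where open ≡-Reasoning
  ... | Bézout.-+ x y eq = + y , divides (+ x) (begin
    + u * + y - 1ℤ         ≡⟨ cong (_- 1ℤ) (trans (pos-* y u) (*-comm (+ y) (+ u))) ⟨
    + (y ℕ.* u) - 1ℤ       ≡⟨ cong (λ z → + z - 1ℤ) eq ⟨
    + (1 ℕ.+ x ℕ.* p) - 1ℤ ≡⟨ cong (_- 1ℤ) (pos-+ 1 (x ℕ.* p)) ⟩
    1ℤ + + (x ℕ.* p) - 1ℤ  ≡⟨ solve 1 (λ a → con 1ℤ :+ a :- con 1ℤ := a) refl (+ (x ℕ.* p)) ⟩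
    + (x ℕ.* p)            ≡⟨ pos-* x p ⟩
    + x * + p              ∎)
    where open ≡-Reasoning

  -- If D g ≡ 1 modulo p^(N+1), then g (2 − D g) inverts D modulo p^(N+2): D g (2 − D g) − 1 = −(D g − 1)².
  inverse-mod-p^ : ∀ {D} → ¬ p ℕ.∣ ∣ D ∣ → ∀ N → ∃[ g ] + (p ℕ.^ suc N) ∣ D * g - 1ℤ
  inverse-mod-p^ {D} p∤D zero with inverse-mod-p {∣ D ∣} p∤D | +∣i∣≡i⊎+∣i∣≡-i D
  ... | g , p∣ | inj₁ ∣D∣≡D  = g , subst (λ x → + x ∣ D * g - 1ℤ) (sym (ℕ.*-identityʳ p))
                                   (subst (λ d → + p ∣ d * g - 1ℤ) ∣D∣≡D p∣)
  ... | g , p∣ | inj₂ ∣D∣≡-D = - g , subst (λ x → + x ∣ D * - g - 1ℤ) (sym (ℕ.*-identityʳ p))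
                                   (subst (λ z → + p ∣ z - 1ℤ) (trans (cong (_* g) ∣D∣≡-D) (trans (sym (neg-distribˡ-* D g)) (neg-distribʳ-* D g))) p∣)
  inverse-mod-p^ {D} p∤D (suc N) with inverse-mod-p^ {D} p∤D N
  ... | g , p^∣ = g * (1ℤ - (D * g - 1ℤ)) , subst₂ _∣_ p^N*p≡ square≡ (∣m⇒∣-m (*-pres-∣ p^∣ (∣-trans p∣p^ p^∣)))
    where
    open IntegerProducts using (*-pres-∣)
    p∣p^ : + p ∣ + (p ℕ.^ suc N)
    p∣p^ = ∣ᵤ⇒∣ (ℕ.m∣m*n (p ℕ.^ N))
    p^N*p≡ : + (p ℕ.^ suc N) * + p ≡ + (p ℕ.^ suc (suc N))
    p^N*p≡ = trans (sym (pos-* (p ℕ.^ suc N) p)) (cong +_ (ℕ.*-comm (p ℕ.^ suc N) p))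
    square≡ : - ((D * g - 1ℤ) * (D * g - 1ℤ)) ≡ D * (g * (1ℤ - (D * g - 1ℤ))) - 1ℤ
    square≡ = solve 2 (λ d g → :- ((d :* g :- con 1ℤ) :* (d :* g :- con 1ℤ)) := d :* (g :* (con 1ℤ :- (d :* g :- con 1ℤ))) :- con 1ℤ) refl D g

  p∤1 : ¬ p ℕ.∣ 1
  p∤1 p∣1 = ℕ.<⇒≢ (Valuation.1<p prime) (sym (ℕ.∣1⇒≡1 p∣1))

  p∤inverse : ∀ {D g} → + p ∣ D * g - 1ℤ → ¬ p ℕ.∣ ∣ g ∣
  p∤inverse {D} {g} p∣Dg-1 p∣g = p∤1 (∣⇒∣ᵤ {+ p} {1ℤ} (subst (+ p ∣_)
    (solve 2 (λ d g → d :* g :- (d :* g :- con 1ℤ) := con 1ℤ) refl D g)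
    (∣m∣n⇒∣m-n (∣n⇒∣m*n D (∣ᵤ⇒∣ p∣g)) p∣Dg-1)))

  p∤^ : ∀ {g} → ¬ p ℕ.∣ ∣ g ∣ → ∀ s → ¬ p ℕ.∣ ∣ g ^ s ∣
  p∤^ p∤g zero = p∤1
  p∤^ {g} p∤g (suc s) p∣g^s with euclidsLemma ∣ g ∣ ∣ g ^ s ∣ prime (subst (p ℕ.∣_) (abs-* g (g ^ s)) p∣g^s)
  ... | inj₁ p∣g   = p∤g p∣g
  ... | inj₂ p∣g^s = p∤^ p∤g s p∣g^s

  p^n∣x*y⇒p^n∣x : ∀ {y} n x → ¬ p ℕ.∣ ∣ y ∣ → + (p ℕ.^ n) ∣ x * y → + (p ℕ.^ n) ∣ x
  p^n∣x*y⇒p^n∣x {y} n x p∤y p^n∣xy =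
    ∣ᵤ⇒∣ (Valuation.p^n∣x*y⇒p^n∣x prime n p∤y (subst (_ ℕ.∣_) (abs-* x y) (∣⇒∣ᵤ p^n∣xy)))

module BinomialCoefficients where

  open import Data.Nat
  open import Data.Nat.Properties
  open import Data.Nat.Combinatorics using (_C_; nC1≡n; nCk+nC[k+1]≡[n+1]C[k+1]; k>n⇒nCk≡0)
  open import Data.Nat.Divisibility
  open import Data.Nat.DivMod using (_%_; %-distribˡ-+)
  open import Data.Nat.Primality using (Prime; prime⇒nonZero)
  open import Data.Nat.Solver using (module +-*-Solver)
  open import Relation.Nullary using (yes; no; contradiction)
  open import Relation.Binary.PropositionalEquality
  open +-*-Solver
  open BigOperators using (∏; ∏-snoc)
  open Valuation using (p^n∣x*y⇒p^n∣x)

  [k+1]*[n+1]C[k+1]≡[n+1]*nCk : ∀ n k → suc k * (suc n C suc k) ≡ suc n * (n C k)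
  [k+1]*[n+1]C[k+1]≡[n+1]*nCk zero    zero    = refl
  [k+1]*[n+1]C[k+1]≡[n+1]*nCk zero    (suc k) = *-zeroʳ (suc (suc k))
  [k+1]*[n+1]C[k+1]≡[n+1]*nCk (suc n) zero    = trans (*-identityˡ _) (trans (nC1≡n (suc (suc n))) (sym (*-identityʳ _)))
  [k+1]*[n+1]C[k+1]≡[n+1]*nCk (suc n) (suc k) = begin
    suc (suc k) * (suc (suc n) C suc (suc k))
      ≡⟨ cong (suc (suc k) *_) (sym (nCk+nC[k+1]≡[n+1]C[k+1] (suc n) (suc k))) ⟩
    suc (suc k) * (suc n C suc k + suc n C suc (suc k))
      ≡⟨ *-distribˡ-+ (suc (suc k)) (suc n C suc k) _ ⟩
    suc (suc k) * (suc n C suc k) + suc (suc k) * (suc n C suc (suc k))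
      ≡⟨ cong₂ (λ x y → suc n C suc k + x + y) ([k+1]*[n+1]C[k+1]≡[n+1]*nCk n k) ([k+1]*[n+1]C[k+1]≡[n+1]*nCk n (suc k)) ⟩
    suc n C suc k + suc n * (n C k) + suc n * (n C suc k)
      ≡⟨ solve 4 (λ a m b c → a :+ m :* b :+ m :* c := a :+ m :* (b :+ c)) refl (suc n C suc k) (suc n) (n C k) (n C suc k) ⟩
    suc n C suc k + suc n * (n C k + n C suc k)
      ≡⟨ cong (λ x → suc n C suc k + suc n * x) (nCk+nC[k+1]≡[n+1]C[k+1] n k) ⟩
    suc (suc n) * (suc n C suc k) ∎
    where open ≡-Reasoning

  ∏[1+c+j]≡s!*[c+s]Cs : ∀ c s → ∏[ j < s ] (suc c + j) ≡ s ! * ((c + s) C s)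
  ∏[1+c+j]≡s!*[c+s]Cs c zero    = refl
  ∏[1+c+j]≡s!*[c+s]Cs c (suc s) = begin
    ∏[ j < suc s ] (suc c + j)              ≡⟨ ∏-snoc s (λ j → suc c + j) ⟩
    ∏[ j < s ] (suc c + j) * suc (c + s)    ≡⟨ cong (_* suc (c + s)) (∏[1+c+j]≡s!*[c+s]Cs c s) ⟩
    s ! * ((c + s) C s) * suc (c + s)       ≡⟨ solve 3 (λ a b m → a :* b :* m := a :* (m :* b)) refl (s !) ((c + s) C s) (suc (c + s)) ⟩
    s ! * (suc (c + s) * ((c + s) C s))     ≡⟨ cong (s ! *_) ([k+1]*[n+1]C[k+1]≡[n+1]*nCk (c + s) s) ⟨
    s ! * (suc s * (suc (c + s) C suc s))   ≡⟨ solve 3 (λ a m b → a :* (m :* b) := m :* a :* b) refl (s !) (suc s) (suc (c + s) C suc s) ⟩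
    suc s ! * (suc (c + s) C suc s)         ≡⟨ cong (λ x → suc s ! * (x C suc s)) (+-suc c s) ⟨
    suc s ! * ((c + suc s) C suc s)         ∎
    where open ≡-Reasoning

  module _ {p} (prime : Prime p) where

    private
      instance _ = prime⇒nonZero prime
      0%p≡0 : 0 % p ≡ 0
      0%p≡0 = n∣m⇒m%n≡0 0 p (divides 0 refl)

    p∣p^KCm : ∀ K m → 0 < m → m < p ^ K → p ∣ (p ^ K) C m
    p∣p^KCm K m 0<m m<p^K = p∣PCm (p ^ K) refl m 0<m m<p^K
      where
      p∣PCm : ∀ P → P ≡ p ^ K → ∀ m → 0 < m → m < P → p ∣ P C m
      p∣PCm (suc n) P≡p^K (suc m) _ m<P with p ∣? (suc n C suc m)
      ... | yes p∣PCm = p∣PCm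
      ... | no  p∤PCm = contradiction (∣⇒≤ (subst (_∣ suc m) (sym P≡p^K) p^K∣m)) (<⇒≱ m<P)
        where
        P∣m*PCm : suc n ∣ suc m * (suc n C suc m)
        P∣m*PCm = divides (n C m) (trans ([k+1]*[n+1]C[k+1]≡[n+1]*nCk n m) (*-comm (suc n) (n C m)))
        p^K∣m : p ^ K ∣ suc m
        p^K∣m = p^n∣x*y⇒p^n∣x prime K p∤PCm (subst (_∣ suc m * (suc n C suc m)) P≡p^K P∣m*PCm)

    [x+p^K]Cm%p≡xCm%p : ∀ K x m → m < p ^ K → ((x + p ^ K) C m) % p ≡ (x C m) % p
    [x+p^K]Cm%p≡xCm%p K zero    zero    _     = refl
    [x+p^K]Cm%p≡xCm%p K zero    (suc m) m<p^K = trans (n∣m⇒m%n≡0 _ p (p∣p^KCm K (suc m) (s≤s z≤n) m<p^K)) (sym 0%p≡0)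
    [x+p^K]Cm%p≡xCm%p K (suc x) zero    _     = refl
    [x+p^K]Cm%p≡xCm%p K (suc x) (suc m) m<p^K = begin
      ((suc x + p ^ K) C suc m) % p
        ≡⟨ cong (_% p) (sym (nCk+nC[k+1]≡[n+1]C[k+1] (x + p ^ K) m)) ⟩
      ((x + p ^ K) C m + (x + p ^ K) C suc m) % p
        ≡⟨ %-distribˡ-+ ((x + p ^ K) C m) _ p ⟩
      (((x + p ^ K) C m) % p + ((x + p ^ K) C suc m) % p) % p
        ≡⟨ cong₂ (λ a b → (a + b) % p) ([x+p^K]Cm%p≡xCm%p K x m (<-trans (n<1+n m) m<p^K)) ([x+p^K]Cm%p≡xCm%p K x (suc m) m<p^K) ⟩
      ((x C m) % p + (x C suc m) % p) % p
        ≡⟨ %-distribˡ-+ (x C m) _ p ⟨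
      (x C m + x C suc m) % p
        ≡⟨ cong (_% p) (nCk+nC[k+1]≡[n+1]C[k+1] x m) ⟩
      (suc x C suc m) % p ∎
      where open ≡-Reasoning

    [x+t*p^K]Cm%p≡xCm%p : ∀ K t x m → m < p ^ K → ((x + t * p ^ K) C m) % p ≡ (x C m) % p
    [x+t*p^K]Cm%p≡xCm%p K zero    x m _     = cong (λ y → (y C m) % p) (+-identityʳ x)
    [x+t*p^K]Cm%p≡xCm%p K (suc t) x m m<p^K = begin
      ((x + suc t * p ^ K) C m) % p    ≡⟨ cong (λ y → (y C m) % p) (solve 3 (λ x t q → x :+ (q :+ t :* q) := x :+ t :* q :+ q) refl x t (p ^ K)) ⟩
      ((x + t * p ^ K + p ^ K) C m) % p ≡⟨ [x+p^K]Cm%p≡xCm%p K (x + t * p ^ K) m m<p^K ⟩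
      ((x + t * p ^ K) C m) % p        ≡⟨ [x+t*p^K]Cm%p≡xCm%p K t x m m<p^K ⟩
      (x C m) % p                      ∎
      where open ≡-Reasoning

    p∣[u+t*p^K]Cm : ∀ K t {u m} → u < m → m < p ^ K → p ∣ (u + t * p ^ K) C m
    p∣[u+t*p^K]Cm K t {u} {m} u<m m<p^K = m%n≡0⇒n∣m _ p (begin
      ((u + t * p ^ K) C m) % p ≡⟨ [x+t*p^K]Cm%p≡xCm%p K t u m m<p^K ⟩
      (u C m) % p               ≡⟨ cong (_% p) (k>n⇒nCk≡0 u<m) ⟩
      0 % p                     ≡⟨ 0%p≡0 ⟩
      0                         ∎)
      where open ≡-Reasoning

    p∣[m+s]Cs : ∀ K {m s i} → i < s → s < p ^ K → p ^ K ∣ suc m + i → p ∣ (m + s) C s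
    p∣[m+s]Cs K {m} {s} {i} i<s s<p^K (divides t 1+m+i≡t*p^K) =
      subst (λ x → p ∣ x C s) (sym m+s≡) (p∣[u+t*p^K]Cm K t (∸-monoʳ-< (s≤s z≤n) i<s) s<p^K)
      where
      m+s≡ : m + s ≡ (s ∸ suc i) + t * p ^ K
      m+s≡ = begin
        m + s                     ≡⟨ cong (m +_) (m+[n∸m]≡n i<s) ⟨
        m + (suc i + (s ∸ suc i)) ≡⟨ +-assoc m (suc i) _ ⟨
        m + suc i + (s ∸ suc i)   ≡⟨ cong (_+ (s ∸ suc i)) (trans (+-suc m i) 1+m+i≡t*p^K) ⟩
        t * p ^ K + (s ∸ suc i)   ≡⟨ +-comm _ (s ∸ suc i) ⟩
        (s ∸ suc i) + t * p ^ K   ∎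
        where open ≡-Reasoning

module Progressions where

  open import Data.Nat as ℕ using (ℕ; suc; _!; NonZero)
  import Data.Nat.Properties as ℕ
  import Data.Nat.Divisibility as ℕ
  open import Data.Nat.Combinatorics using (_C_)
  open import Data.Nat.Primality using (prime⇒nonZero)
  open import Data.Integer using (ℤ; +_; -_; _+_; _-_; _*_; _^_; 0ℤ; 1ℤ; ∣_∣)
  open import Data.Integer.Properties
  open import Data.Integer.Divisibility.Signed
  open import Data.Integer.DivMod using (_%ℕ_; _/ℕ_; a≡a%ℕn+[a/ℕn]*n)
  open import Data.Integer.Solver using (module +-*-Solver)
  open import Data.Product using (∃-syntax; _,_; proj₁; proj₂)
  open import Relation.Nullary using (¬_)
  open import Relation.Binary.PropositionalEquality
  open +-*-Solver
  open IntegerProducts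

  progression≡consecutive : ∀ Q .{{_ : NonZero Q}} {D g} c → + Q ∣ D * g - 1ℤ →
                            ∃[ m ] ∀ j → + Q ∣ g * (c + + j * D) - + (suc m ℕ.+ j)
  progression≡consecutive Q {D} {g} c Q∣Dg-1 = r ℕ.+ ℕ.pred Q , Q∣
    where
    -- 1 + m = (c g mod Q) + Q ≡ c g, and the extra Q keeps m a natural number.
    r = (c * g) %ℕ Q
    q = (c * g) /ℕ Q
    1+m+j≡ : ∀ j → + (suc (r ℕ.+ ℕ.pred Q) ℕ.+ j) ≡ + r + + Q + + j
    1+m+j≡ j = begin
      + (suc (r ℕ.+ ℕ.pred Q) ℕ.+ j) ≡⟨ cong (λ x → + (x ℕ.+ j)) (trans (sym (ℕ.+-suc r _)) (cong (r ℕ.+_) (ℕ.suc-pred Q))) ⟩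
      + (r ℕ.+ Q ℕ.+ j)              ≡⟨ pos-+ (r ℕ.+ Q) j ⟩
      + (r ℕ.+ Q) + + j              ≡⟨ cong (_+ + j) (pos-+ r Q) ⟩
      + r + + Q + + j                ∎
      where open ≡-Reasoning
    Q∣ : ∀ j → + Q ∣ g * (c + + j * D) - + (suc (r ℕ.+ ℕ.pred Q) ℕ.+ j)
    Q∣ j = subst (+ Q ∣_) eq (∣m∣n⇒∣m+n (∣n⇒∣m*n (+ j) Q∣Dg-1) (∣n⇒∣m*n (q - 1ℤ) ∣-refl))
      where
      eq : + j * (D * g - 1ℤ) + (q - 1ℤ) * + Q ≡ g * (c + + j * D) - + (suc (r ℕ.+ ℕ.pred Q) ℕ.+ j)
      eq = begin
        + j * (D * g - 1ℤ) + (q - 1ℤ) * + Q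
          ≡⟨ solve 7 (λ j d g c r q Q → j :* (d :* g :- con 1ℤ) :+ (q :- con 1ℤ) :* Q
                                      := g :* (c :+ j :* d) :- (r :+ Q :+ j) :+ ((r :+ q :* Q) :- c :* g))
                     refl (+ j) D g c (+ r) q (+ Q) ⟩
        g * (c + + j * D) - (+ r + + Q + + j) + ((+ r + q * + Q) - c * g)
          ≡⟨ cong (λ x → g * (c + + j * D) - (+ r + + Q + + j) + (x - c * g)) (sym (a≡a%ℕn+[a/ℕn]*n (c * g) Q)) ⟩
        g * (c + + j * D) - (+ r + + Q + + j) + (c * g - c * g)
          ≡⟨ cong (λ x → g * (c + + j * D) - (+ r + + Q + + j) + x) (+-inverseʳ (c * g)) ⟩
        g * (c + + j * D) - (+ r + + Q + + j) + 0ℤ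
          ≡⟨ +-identityʳ _ ⟩
        g * (c + + j * D) - (+ r + + Q + + j)
          ≡⟨ cong (λ x → g * (c + + j * D) - x) (1+m+j≡ j) ⟨
        g * (c + + j * D) - + (suc (r ℕ.+ ℕ.pred Q) ℕ.+ j) ∎
        where open ≡-Reasoning

  module _ {p} (prime : Prime p) where

    open ModPrimePowers prime
    open BinomialCoefficients using (∏[1+c+j]≡s!*[c+s]Cs; p∣[m+s]Cs)
    open Valuation using (p^m∣p^n)

    p^[1+w]∣∏progression : ∀ K w {s i c D} → ¬ p ℕ.∣ ∣ D ∣ → i ℕ.< s → s ℕ.< p ℕ.^ K → p ℕ.^ w ℕ.∣ s ! →
                           + (p ℕ.^ K) ∣ c + + i * D → + (p ℕ.^ suc w) ∣ ∏ℤ[ j < s ] (c + + j * D)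
    p^[1+w]∣∏progression K w {s} {i} {c} {D} p∤D i<s s<p^K p^w∣s! p^K∣c+iD =
      p^n∣x*y⇒p^n∣x (suc w) _ (p∤^ p∤g s) (subst (+ (p ℕ.^ suc w) ∣_) (*-comm (g ^ s) _) p^[1+w]∣g^s∏)
      where
      Q = p ℕ.^ suc (w ℕ.+ K)
      instance _ = ℕ.m^n≢0 p (suc (w ℕ.+ K)) {{prime⇒nonZero prime}}
      g : ℤ
      g = proj₁ (inverse-mod-p^ {D} p∤D (w ℕ.+ K))
      Q∣Dg-1 : + Q ∣ D * g - 1ℤ
      Q∣Dg-1 = proj₂ (inverse-mod-p^ {D} p∤D (w ℕ.+ K))
      p∤g : ¬ p ℕ.∣ ∣ g ∣
      p∤g = p∤inverse {D} (∣-trans (∣ᵤ⇒∣ (ℕ.m∣m*n (p ℕ.^ (w ℕ.+ K)))) Q∣Dg-1)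
      m : ℕ
      m = proj₁ (progression≡consecutive Q {D} {g} c Q∣Dg-1)
      Q∣g[c+jD]-[1+m+j] : ∀ j → + Q ∣ g * (c + + j * D) - + (suc m ℕ.+ j)
      Q∣g[c+jD]-[1+m+j] = proj₂ (progression≡consecutive Q {D} {g} c Q∣Dg-1)
      p^K∣1+m+i : p ℕ.^ K ℕ.∣ suc m ℕ.+ i
      p^K∣1+m+i = ∣⇒∣ᵤ (subst (+ (p ℕ.^ K) ∣_) (solve 2 (λ x y → x :- (x :- y) := y) refl (g * (c + + i * D)) (+ (suc m ℕ.+ i)))
        (∣m∣n⇒∣m-n (∣n⇒∣m*n g p^K∣c+iD) (∣-trans (∣ᵤ⇒∣ (p^m∣p^n p (ℕ.≤-trans (ℕ.m≤n+m K w) (ℕ.n≤1+n _)))) (Q∣g[c+jD]-[1+m+j] i))))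
      p^[1+w]∣s!*binom : p ℕ.^ suc w ℕ.∣ s ! ℕ.* ((m ℕ.+ s) C s)
      p^[1+w]∣s!*binom = subst (ℕ._∣ s ! ℕ.* ((m ℕ.+ s) C s)) (ℕ.*-comm (p ℕ.^ w) p)
        (ℕ.*-pres-∣ p^w∣s! (p∣[m+s]Cs prime K i<s s<p^K p^K∣1+m+i))
      Q∣g^s∏-s!*binom : + Q ∣ g ^ s * ∏ℤ[ j < s ] (c + + j * D) - + (s ! ℕ.* ((m ℕ.+ s) C s))
      Q∣g^s∏-s!*binom = subst₂ (λ x y → + Q ∣ x - y) (∏ℤ-scale s g (λ j → c + + j * D))
        (trans (∏ℤ-pos s (λ j → suc m ℕ.+ j)) (cong +_ (∏[1+c+j]≡s!*[c+s]Cs m s)))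
        (∏ℤ-congruence s (+ Q) (λ j _ → Q∣g[c+jD]-[1+m+j] j))
      p^[1+w]∣g^s∏ : + (p ℕ.^ suc w) ∣ g ^ s * ∏ℤ[ j < s ] (c + + j * D)
      p^[1+w]∣g^s∏ = subst (+ (p ℕ.^ suc w) ∣_) (solve 2 (λ x y → x :- y :+ y := x) refl _ _)
        (∣m∣n⇒∣m+n (∣-trans (∣ᵤ⇒∣ (p^m∣p^n p (ℕ.s≤s (ℕ.m≤m+n w K)))) Q∣g^s∏-s!*binom) (∣ᵤ⇒∣ p^[1+w]∣s!*binom))

module ArithmeticProgression {p} (prime : Prime p) (k a d : ℕ) .{{_ : NonZero a}} .{{_ : NonZero d}} where

  open import Data.Nat as ℕ using (zero; suc; z≤n; s≤s; _∸_; _!)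
  import Data.Nat.Properties as ℕ
  import Data.Nat.Divisibility as ℕ
  open import Data.Nat.Primality using (prime⇒nonZero)
  open import Data.Integer using (ℤ; +_; -_; _+_; _-_; _*_; _^_; 1ℤ; ∣_∣)
  open import Data.Integer.Properties
  open import Data.Integer.Divisibility.Signed
  open import Data.Integer.Solver using (module +-*-Solver)
  open import Data.Product using (_,_)
  open import Relation.Nullary using (¬_; yes; no)
  open import Data.Sum using (_⊎_; inj₁; inj₂; [_,_]′)
  open import Relation.Binary.PropositionalEquality
  open +-*-Solver
  open BigOperators using (∑; ∑-bound)
  open Valuation using (p^m∣p^n; p^v[m]∣m; p^e∤x⇒v<e)
  open IntegerProducts

  private instance _ = prime⇒nonZero prime

  ℓ : ℕ → ℕ
  ℓ j = a ℕ.+ j ℕ.* d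

  +ℓ≡ : ∀ j → + ℓ j ≡ + a + + j * + d
  +ℓ≡ j = trans (pos-+ a (j ℕ.* d)) (cong (λ x → + a + x) (pos-* j d))

  m-ℓj≡m-ℓi+[i-j]d : ∀ m i j → + m - + ℓ j ≡ (+ m - + ℓ i) + (+ i - + j) * + d
  m-ℓj≡m-ℓi+[i-j]d m i j = begin
    + m - + ℓ j                              ≡⟨ cong (λ x → + m - x) (+ℓ≡ j) ⟩
    + m - (+ a + + j * + d)                  ≡⟨ solve 5 (λ m a d i j → m :- (a :+ j :* d) := (m :- (a :+ i :* d)) :+ (i :- j) :* d) refl (+ m) (+ a) (+ d) (+ i) (+ j) ⟩
    (+ m - (+ a + + i * + d)) + (+ i - + j) * + d ≡⟨ cong (λ x → (+ m - x) + (+ i - + j) * + d) (+ℓ≡ i) ⟨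
    (+ m - + ℓ i) + (+ i - + j) * + d        ∎
    where open ≡-Reasoning

  p^e∣m-ℓj : ∀ {e m i} → e ℕ.≤ k → p ℕ.^ e ℕ.∣ d → + (p ℕ.^ k) ∣ + m - + ℓ i → ∀ j → + (p ℕ.^ e) ∣ + m - + ℓ j
  p^e∣m-ℓj {e} {m} {i} e≤k p^e∣d q∣m-ℓi j = subst (+ (p ℕ.^ e) ∣_) (sym (m-ℓj≡m-ℓi+[i-j]d m i j))
    (∣m∣n⇒∣m+n (∣-trans (∣ᵤ⇒∣ (p^m∣p^n p e≤k)) q∣m-ℓi) (∣n⇒∣m*n (+ i - + j) (∣ᵤ⇒∣ p^e∣d)))

  p^[[s-1]e+k]∣∏ : ∀ {e s m i} → i ℕ.< s → (∀ j → + (p ℕ.^ e) ∣ + m - + ℓ j) → + (p ℕ.^ k) ∣ + m - + ℓ i →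
                   + (p ℕ.^ ((s ∸ 1) ℕ.* e ℕ.+ k)) ∣ ∏ℤ[ j < s ] (+ m - + ℓ j)
  p^[[s-1]e+k]∣∏ {e} {s} {m} {i} i<s p^e∣ q∣ =
    subst (_∣ ∏ℤ[ j < s ] (+ m - + ℓ j)) ([+p^e]^s*+p^x≡+p^[se+x] p e (s ∸ 1) k)
      (∏ℤ-divisible-one s i (+ (p ℕ.^ e)) (+ (p ℕ.^ k)) (λ j → + m - + ℓ j) i<s (λ j _ _ → p^e∣ j) q∣)
      where open ≡-Reasoning

  p^[1+∑v]∣∏ : ∀ {e s m} → 0 ℕ.< s → ¬ p ℕ.^ e ℕ.∣ a → p ℕ.^ e ℕ.∣ d → (∀ j → + (p ℕ.^ e) ∣ + m - + ℓ j) →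
               + (p ℕ.^ suc (∑[ j < s ] v p (ℓ j))) ∣ ∏ℤ[ j < s ] (+ m - + ℓ j)
  p^[1+∑v]∣∏ {e} {s} {m} 0<s p^e∤a p^e∣d p^e∣ =
    ∣-trans (∣ᵤ⇒∣ (p^m∣p^n p 1+V≤se))
      (subst (_∣ ∏ℤ[ j < s ] (+ m - + ℓ j)) (trans (sym (pos-^ (p ℕ.^ e) s)) (cong +_ (ℕ.^-*-assoc p e s)))
        (∏ℤ-divisible s (+ (p ℕ.^ e)) (λ j → + m - + ℓ j) λ j _ → p^e∣ j))
    where
    v[ℓj]<e : ∀ j → v p (ℓ j) ℕ.< e
    v[ℓj]<e j = p^e∤x⇒v<e e λ p^e∣ℓj → p^e∤a (ℕ.∣m+n∣m⇒∣n (subst (p ℕ.^ e ℕ.∣_) (ℕ.+-comm a (j ℕ.* d)) p^e∣ℓj)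
                                                        (ℕ.∣n⇒∣m*n j p^e∣d))
    1+V≤se : suc (∑[ j < s ] v p (ℓ j)) ℕ.≤ e ℕ.* s
    V = ∑[ j < s ] v p (ℓ j)
    1+V≤se = ℕ.≤-trans (subst (ℕ._≤ V ℕ.+ s) (ℕ.+-comm V 1) (ℕ.+-monoʳ-≤ V 0<s))
               (subst (V ℕ.+ s ℕ.≤_) (ℕ.*-comm s e) (∑-bound s (λ j → v p (ℓ j)) e λ j _ → v[ℓj]<e j))

  s<p^[k∸e] : ∀ {e s a′ u} → e ℕ.≤ k → 0 ℕ.< s → a ≡ a′ ℕ.* p ℕ.^ e → d ≡ p ℕ.^ e ℕ.* u →
              ℓ (s ∸ 1) ℕ.< p ℕ.^ k → s ℕ.< p ℕ.^ (k ∸ e)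
  s<p^[k∸e] {e} {s@(suc s′)} {a′} {u} e≤k _ a≡ d≡ ℓ<p^k = ℕ.≤-<-trans s≤x x<p^[k∸e]
    where
    x = a′ ℕ.+ s′ ℕ.* u
    s≤x : s ℕ.≤ x
    s≤x = ℕ.+-mono-≤ (ℕ.n≢0⇒n>0 λ { refl → ℕ.≢-nonZero⁻¹ a a≡ })
                     (ℕ.m≤m*n s′ u {{ℕ.≢-nonZero λ { refl → ℕ.≢-nonZero⁻¹ d (trans d≡ (ℕ.*-zeroʳ (p ℕ.^ e))) }}})
    x<p^[k∸e] : x ℕ.< p ℕ.^ (k ∸ e)
    x<p^[k∸e] = ℕ.*-cancelˡ-< (p ℕ.^ e) x _ (subst₂ ℕ._<_ ℓ≡ p^k≡ ℓ<p^k)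
      where
      ℓ≡ : ℓ s′ ≡ p ℕ.^ e ℕ.* x
      ℓ≡ = begin
        a ℕ.+ s′ ℕ.* d                          ≡⟨ cong₂ (λ a d → a ℕ.+ s′ ℕ.* d) a≡ d≡ ⟩
        a′ ℕ.* p ℕ.^ e ℕ.+ s′ ℕ.* (p ℕ.^ e ℕ.* u) ≡⟨ cong₂ ℕ._+_ (ℕ.*-comm a′ _) (trans (sym (ℕ.*-assoc s′ (p ℕ.^ e) u)) (trans (cong (ℕ._* u) (ℕ.*-comm s′ _)) (ℕ.*-assoc (p ℕ.^ e) s′ u))) ⟩
        p ℕ.^ e ℕ.* a′ ℕ.+ p ℕ.^ e ℕ.* (s′ ℕ.* u) ≡⟨ ℕ.*-distribˡ-+ (p ℕ.^ e) a′ _ ⟨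
        p ℕ.^ e ℕ.* x                            ∎
        where open ≡-Reasoning
      p^k≡ : p ℕ.^ k ≡ p ℕ.^ e ℕ.* p ℕ.^ (k ∸ e)
      p^k≡ = trans (cong (p ℕ.^_) (sym (ℕ.m+[n∸m]≡n e≤k))) (ℕ.^-distribˡ-+-* p e (k ∸ e))

  p^[se+1+v[s!]]∣∏ : ∀ {s m i} → i ℕ.< s → p ℕ.^ v p d ℕ.∣ a → v p d ℕ.≤ k → ℓ (s ∸ 1) ℕ.< p ℕ.^ k →
                     + (p ℕ.^ k) ∣ + m - + ℓ i → + (p ℕ.^ (s ℕ.* v p d ℕ.+ suc (v p (s !)))) ∣ ∏ℤ[ j < s ] (+ m - + ℓ j)
  p^[se+1+v[s!]]∣∏ {s} {m} {i} i<s (ℕ.divides a′ a≡) e≤k ℓ<p^k q∣m-ℓi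
    with Valuation.valuation-split {m = d} (Valuation.1<p prime)
  ... | u , d≡ , p∤u = subst₂ _∣_ ([+p^e]^s*+p^x≡+p^[se+x] p e s (suc w)) (sym ∏≡) (*-pres-∣ (∣-refl {(+ (p ℕ.^ e)) ^ s}) p^[1+w]∣∏[y-ju])
    where
    e = v p d
    w = v p (s !)
    D = - + u
    p^e∣m-a : + (p ℕ.^ e) ∣ + m - + a
    p^e∣m-a = subst (λ x → + (p ℕ.^ e) ∣ + m - + x) (ℕ.+-identityʳ a)
                (p^e∣m-ℓj {i = i} e≤k (ℕ.divides u (trans d≡ (ℕ.*-comm _ u))) q∣m-ℓi 0)
    y : ℤ
    y = quotient p^e∣m-a
    m-ℓj≡ : ∀ j → + m - + ℓ j ≡ + (p ℕ.^ e) * (y + + j * D)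
    m-ℓj≡ j = begin
      + m - + ℓ j                       ≡⟨ cong (λ x → + m - x) (+ℓ≡ j) ⟩
      + m - (+ a + + j * + d)           ≡⟨ solve 4 (λ m a j d → m :- (a :+ j :* d) := (m :- a) :- j :* d) refl (+ m) (+ a) (+ j) (+ d) ⟩
      (+ m - + a) - + j * + d           ≡⟨ cong₂ (λ x z → x - + j * z) (_∣_.equality p^e∣m-a) (trans (cong +_ d≡) (pos-* (p ℕ.^ e) u)) ⟩
      y * + (p ℕ.^ e) - + j * (+ (p ℕ.^ e) * + u)
                                        ≡⟨ solve 4 (λ y q j u → y :* q :- j :* (q :* u) := q :* (y :+ j :* (:- u))) refl y (+ (p ℕ.^ e)) (+ j) (+ u) ⟩
      + (p ℕ.^ e) * (y + + j * D)       ∎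
      where open ≡-Reasoning
    p^[k∸e]∣y+iD : + (p ℕ.^ (k ∸ e)) ∣ y + + i * D
    p^[k∸e]∣y+iD = *-cancelˡ-∣ (+ (p ℕ.^ e)) {{pos-nonZero}} (subst₂ _∣_ q≡ (m-ℓj≡ i) q∣m-ℓi)
      where
      instance pos-nonZero = ℕ.m^n≢0 p e
      q≡ : + (p ℕ.^ k) ≡ + (p ℕ.^ e) * + (p ℕ.^ (k ∸ e))
      q≡ = trans (cong (λ x → + (p ℕ.^ x)) (sym (ℕ.m+[n∸m]≡n e≤k)))
                 (trans (cong +_ (ℕ.^-distribˡ-+-* p e (k ∸ e))) (pos-* (p ℕ.^ e) _))
    p^[1+w]∣∏[y-ju] : + (p ℕ.^ suc w) ∣ ∏ℤ[ j < s ] (y + + j * D)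
    p^[1+w]∣∏[y-ju] = Progressions.p^[1+w]∣∏progression prime (k ∸ e) w {s} {i} {y} {D}
      (subst (λ x → ¬ p ℕ.∣ x) (sym (∣-i∣≡∣i∣ (+ u))) p∤u) i<s
      (s<p^[k∸e] {a′ = a′} e≤k (ℕ.≤-<-trans ℕ.z≤n i<s) a≡ d≡ ℓ<p^k) (p^v[m]∣m p (s !)) p^[k∸e]∣y+iD
    ∏≡ : ∏ℤ[ j < s ] (+ m - + ℓ j) ≡ (+ (p ℕ.^ e)) ^ s * ∏ℤ[ j < s ] (y + + j * D)
    ∏≡ = trans (∏ℤ-cong s λ j _ → m-ℓj≡ j) (∏ℤ-scale s (+ (p ℕ.^ e)) (λ j → y + + j * D))

  p^[1+∑v]∣∏[m-ℓj] : ∀ s {m i} → i ℕ.< s → ℓ (s ∸ 1) ℕ.< p ℕ.^ k → + (p ℕ.^ k) ∣ + m - + ℓ i →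
                     ∑[ j < s ] v p (ℓ j) ℕ.< ((s ∸ 1) ℕ.* v p d ℕ.+ k) ℕ.⊔ (s ℕ.* v p d ℕ.+ v p (s !) ℕ.+ 1) →
                     + (p ℕ.^ suc (∑[ j < s ] v p (ℓ j))) ∣ ∏ℤ[ j < s ] (+ m - + ℓ j)
  p^[1+∑v]∣∏[m-ℓj] (suc zero) {m} {zero} _ ℓ0<p^k q∣m-ℓ0 _ =
    ∣m⇒∣m*n 1ℤ (∣-trans (∣ᵤ⇒∣ (p^m∣p^n p (subst (ℕ._< k) (sym (ℕ.+-identityʳ _)) (Valuation.x<p^k⇒v<k k ℓ0<p^k)))) q∣m-ℓ0)
    where instance _ = ℕ.>-nonZero (ℕ.<-≤-trans (ℕ.>-nonZero⁻¹ a) (ℕ.m≤m+n a 0))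
  p^[1+∑v]∣∏[m-ℓj] (suc zero) {i = suc _} (s≤s ())
  p^[1+∑v]∣∏[m-ℓj] s@(suc (suc s′)) {m} {i} i<s ℓ<p^k q∣m-ℓi V<X⊔Y = [ caseX , caseY ]′ V<X⊎V<Y
    where
    e = v p d
    V = ∑[ j < s ] v p (ℓ j)
    X = (s ∸ 1) ℕ.* e ℕ.+ k
    Y = s ℕ.* e ℕ.+ v p (s !) ℕ.+ 1
    V<X⊎V<Y : V ℕ.< X ⊎ V ℕ.< Y
    V<X⊎V<Y with ℕ.⊔-sel X Y
    ... | inj₁ X⊔Y≡X = inj₁ (subst (V ℕ.<_) X⊔Y≡X V<X⊔Y)
    ... | inj₂ X⊔Y≡Y = inj₂ (subst (V ℕ.<_) X⊔Y≡Y V<X⊔Y)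
    e≤k : e ℕ.≤ k
    e≤k = ℕ.<⇒≤ (Valuation.x<p^k⇒v<k k (ℕ.≤-<-trans (ℕ.≤-trans (ℕ.m≤m+n d (s′ ℕ.* d)) (ℕ.m≤n+m _ a)) ℓ<p^k))
    p^e∣m-ℓ : ∀ j → + (p ℕ.^ e) ∣ + m - + ℓ j
    p^e∣m-ℓ = p^e∣m-ℓj {i = i} e≤k (p^v[m]∣m p d) q∣m-ℓi
    caseX : V ℕ.< X → + (p ℕ.^ suc V) ∣ ∏ℤ[ j < s ] (+ m - + ℓ j)
    caseX V<X = ∣-trans (∣ᵤ⇒∣ (p^m∣p^n p V<X)) (p^[[s-1]e+k]∣∏ {e} i<s p^e∣m-ℓ q∣m-ℓi)
    caseY : V ℕ.< Y → + (p ℕ.^ suc V) ∣ ∏ℤ[ j < s ] (+ m - + ℓ j)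
    caseY V<Y with p ℕ.^ e ℕ.∣? a
    ... | no  p^e∤a = p^[1+∑v]∣∏ {e} {s} (s≤s z≤n) p^e∤a (p^v[m]∣m p d) p^e∣m-ℓ
    ... | yes p^e∣a = ∣-trans (∣ᵤ⇒∣ (p^m∣p^n p 1+V≤se+1+w)) (p^[se+1+v[s!]]∣∏ i<s p^e∣a e≤k ℓ<p^k q∣m-ℓi)
      where
      1+V≤se+1+w : suc V ℕ.≤ s ℕ.* e ℕ.+ suc (v p (s !))
      1+V≤se+1+w = subst (suc V ℕ.≤_) (trans (ℕ.+-assoc (s ℕ.* e) _ 1) (cong (s ℕ.* e ℕ.+_) (ℕ.+-comm _ 1))) V<Y

module CubePolynomials where

  open import Data.Nat as ℕ using (zero; suc)
  import Data.Nat.Properties as ℕ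
  open import Data.Integer using (ℤ; +_; -_; _+_; _-_; _*_; 0ℤ; 1ℤ)
  open import Data.Integer.Properties
  open import Data.Integer.Solver using (module +-*-Solver)
  open import Data.Bool using (true; false)
  open import Data.Vec using (_∷_; [])
  open import Data.Fin.Subset using (Subset; _─_; ∣_∣)
  open import Data.Unit using (⊤; tt)
  open import Data.Product using (_×_; _,_)
  open import Function using (_∘_)
  open import Relation.Binary.PropositionalEquality
  open +-*-Solver
  open IntegerProducts using (∏ℤ)

  -- g agrees on the cube with a polynomial of degree < t.
  Deg< : (n t : ℕ) → (Subset n → ℤ) → Set
  Deg< n       zero    g = ∀ x → g x ≡ 0ℤ
  Deg< zero    (suc t) g = ⊤
  Deg< (suc n) (suc t) g = Deg< n (suc t) (λ x → g (false ∷ x)) × Deg< n t (λ x → g (true ∷ x) - g (false ∷ x))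

  Deg<-cong : ∀ n t {g h} → (∀ x → g x ≡ h x) → Deg< n t g → Deg< n t h
  Deg<-cong n       zero    g≡h dg x = trans (sym (g≡h x)) (dg x)
  Deg<-cong zero    (suc t) g≡h dg = tt
  Deg<-cong (suc n) (suc t) g≡h (dg₀ , δg) =
    Deg<-cong n (suc t) (g≡h ∘ (false ∷_)) dg₀ ,
    Deg<-cong n t (λ x → cong₂ _-_ (g≡h (true ∷ x)) (g≡h (false ∷ x))) δg

  Deg<-0 : ∀ n t {g} → (∀ x → g x ≡ 0ℤ) → Deg< n t g
  Deg<-0 n       zero    g≡0 = g≡0
  Deg<-0 zero    (suc t) g≡0 = tt
  Deg<-0 (suc n) (suc t) g≡0 =
    Deg<-0 n (suc t) (g≡0 ∘ (false ∷_)) ,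
    Deg<-0 n t (λ x → trans (cong₂ _-_ (g≡0 (true ∷ x)) (g≡0 (false ∷ x))) refl)

  Deg<-+ : ∀ n t {g h} → Deg< n t g → Deg< n t h → Deg< n t (λ x → g x + h x)
  Deg<-+ n       zero    dg dh x = cong₂ _+_ (dg x) (dh x)
  Deg<-+ zero    (suc t) dg dh = tt
  Deg<-+ (suc n) (suc t) {g} {h} (dg₀ , δg) (dh₀ , δh) =
    Deg<-+ n (suc t) dg₀ dh₀ ,
    Deg<-cong n t (λ x → solve 4 (λ a b c d → (a :- b) :+ (c :- d) := (a :+ c) :- (b :+ d)) refl
                           (g (true ∷ x)) (g (false ∷ x)) (h (true ∷ x)) (h (false ∷ x)))
      (Deg<-+ n t δg δh)

  Deg<-suc : ∀ n t {g} → Deg< n t g → Deg< n (suc t) g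
  Deg<-suc n       zero    dg = Deg<-0 n 1 dg
  Deg<-suc zero    (suc t) dg = tt
  Deg<-suc (suc n) (suc t) (dg₀ , δg) = Deg<-suc n (suc t) dg₀ , Deg<-suc n t δg

  Deg<-const : ∀ n t c → Deg< n (suc t) (λ _ → c)
  Deg<-const zero    t c = tt
  Deg<-const (suc n) t c = Deg<-const n t c , Deg<-0 n t (λ _ → +-inverseʳ c)

  Deg<-* : ∀ n a b {g h} → Deg< n (suc a) g → Deg< n (suc b) h → Deg< n (suc (a ℕ.+ b)) (λ x → g x * h x)
  Deg<-* zero    a b dg dh = tt
  Deg<-* (suc n) a b {g} {h} (dg₀ , δg) (dh₀ , δh) =
    Deg<-* n a b dg₀ dh₀ ,
    Deg<-cong n (a ℕ.+ b) (λ x → solve 4 (λ g₁ g₀ h₁ h₀ → (g₁ :- g₀) :* h₁ :+ g₀ :* (h₁ :- h₀) := g₁ :* h₁ :- g₀ :* h₀) refl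
                                   (g (true ∷ x)) (g (false ∷ x)) (h (true ∷ x)) (h (false ∷ x)))
      (Deg<-+ n (a ℕ.+ b) (δg*h₁ a δg) (g₀*δh b δh))
    where
    dh₁ : Deg< n (suc b) (λ x → h (true ∷ x))
    dh₁ = Deg<-cong n (suc b) (λ x → solve 2 (λ h₁ h₀ → h₀ :+ (h₁ :- h₀) := h₁) refl (h (true ∷ x)) (h (false ∷ x)))
            (Deg<-+ n (suc b) dh₀ (Deg<-suc n b δh))
    δg*h₁ : ∀ a′ → Deg< n a′ (λ x → g (true ∷ x) - g (false ∷ x)) →
            Deg< n (a′ ℕ.+ b) (λ x → (g (true ∷ x) - g (false ∷ x)) * h (true ∷ x))
    δg*h₁ zero     δ = Deg<-0 n b (λ x → cong (_* h (true ∷ x)) (δ x))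
    δg*h₁ (suc a′) δ = Deg<-* n a′ b δ dh₁
    g₀*δh : ∀ b′ → Deg< n b′ (λ x → h (true ∷ x) - h (false ∷ x)) →
            Deg< n (a ℕ.+ b′) (λ x → g (false ∷ x) * (h (true ∷ x) - h (false ∷ x)))
    g₀*δh zero     δ = Deg<-0 n (a ℕ.+ 0) (λ x → trans (cong (g (false ∷ x) *_) (δ x)) (*-zeroʳ (g (false ∷ x))))
    g₀*δh (suc b′) δ = subst (λ t → Deg< n t (λ x → g (false ∷ x) * (h (true ∷ x) - h (false ∷ x)))) (sym (ℕ.+-suc a b′)) (Deg<-* n a b′ dg₀ δ)

  Deg<-∣A─x∣ : ∀ n (A : Subset n) → Deg< n 2 (λ x → + ∣ A ─ x ∣)
  Deg<-∣A─x∣ zero    []          = tt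
  Deg<-∣A─x∣ (suc n) (true  ∷ A) =
    Deg<-+ n 2 (Deg<-const n 1 1ℤ) (Deg<-∣A─x∣ n A) ,
    Deg<-cong n 1 (λ x → solve 1 (λ c → :- con 1ℤ := c :- (con 1ℤ :+ c)) refl (+ ∣ A ─ x ∣)) (Deg<-const n 0 (- 1ℤ))
  Deg<-∣A─x∣ (suc n) (false ∷ A) = Deg<-∣A─x∣ n A , Deg<-0 n 1 (λ x → +-inverseʳ (+ ∣ A ─ x ∣))

  Deg<-∏ : ∀ n s (g : ℕ → Subset n → ℤ) → (∀ j → Deg< n 2 (g j)) → Deg< n (suc s) (λ x → ∏ℤ s (λ j → g j x))
  Deg<-∏ n zero    g dg = Deg<-const n 0 1ℤ
  Deg<-∏ n (suc s) g dg = Deg<-* n 1 s (dg 0) (Deg<-∏ n s (g ∘ suc) (dg ∘ suc))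

  Deg<-∏[∣A─x∣-ℓj] : ∀ n s (A : Subset n) (ℓ : ℕ → ℕ) → Deg< n (suc s) (λ x → ∏ℤ s (λ j → + ∣ A ─ x ∣ - + ℓ j))
  Deg<-∏[∣A─x∣-ℓj] n s A ℓ = Deg<-∏ n s (λ j x → + ∣ A ─ x ∣ - + ℓ j)
    (λ j → Deg<-+ n 2 (Deg<-∣A─x∣ n A) (Deg<-const n 1 (- + ℓ j)))

module Monomials where

  open import Data.Nat as ℕ using (zero; suc; _+_)
  import Data.Nat.Properties as ℕ
  open import Data.Nat.Combinatorics using (_C_; nCk+nC[k+1]≡[n+1]C[k+1])
  open import Data.Integer as ℤ using (ℤ; 0ℤ; 1ℤ) renaming (_+_ to _+ℤ_; _*_ to _*ℤ_; _-_ to _-ℤ_)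
  open import Data.Integer.Properties using (*-zeroʳ)
  open import Data.Integer.Solver using (module +-*-Solver)
  open import Data.Bool using (true; false; if_then_else_)
  open import Data.Vec as Vec using (Vec; []; _∷_)
  import Data.Vec.Properties as Vec
  open import Data.List as List using (List; []; _∷_; _++_; length)
  import Data.List.Properties as List
  open import Data.List.Relation.Unary.All as All using (All; []; _∷_)
  import Data.List.Relation.Unary.All.Properties as All
  open import Data.Fin.Subset using (Subset)
  open import Data.Product using (_,_)
  open import Function using (_∘_)
  open import Relation.Binary.PropositionalEquality
  open +-*-Solver
  open BigOperators using (∑; ∑-cong; ∑-+)
  open CubePolynomials using (Deg<)

  infix 7 _·_
  _·_ : ∀ {N} → Vec ℤ N → Vec ℤ N → ℤ
  []       · []       = 0ℤ
  (r ∷ rs) · (z ∷ zs) = r *ℤ z +ℤ rs · zs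

  x₀*_ : ∀ {n} → (Subset n → ℤ) → Subset (suc n) → ℤ
  (x₀* b) (x ∷ xs) = if x then b xs else 0ℤ

  monomials : (n t : ℕ) → List (Subset n → ℤ)
  monomials n       zero    = []
  monomials zero    (suc t) = (λ _ → 1ℤ) ∷ []
  monomials (suc n) (suc t) = List.map (_∘ Vec.tail) (monomials n (suc t)) ++ List.map x₀*_ (monomials n t)

  length-monomials : ∀ n t → length (monomials n t) ≡ ∑[ i < t ] (n C i)
  length-monomials n       zero    = refl
  length-monomials zero    (suc t) = cong suc (sym (∑-0 t))
    where
    ∑-0 : ∀ t → ∑[ i < t ] (0 C suc i) ≡ 0
    ∑-0 zero    = refl
    ∑-0 (suc t) = ∑-0 t
  length-monomials (suc n) (suc t) = begin
    length (List.map (_∘ Vec.tail) (monomials n (suc t)) ++ List.map x₀*_ (monomials n t))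
      ≡⟨ List.length-++ (List.map (_∘ Vec.tail) (monomials n (suc t))) ⟩
    length (List.map (_∘ Vec.tail) (monomials n (suc t))) + length (List.map x₀*_ (monomials n t))
      ≡⟨ cong₂ _+_ (List.length-map (_∘ Vec.tail) (monomials n (suc t))) (List.length-map x₀*_ (monomials n t)) ⟩
    length (monomials n (suc t)) + length (monomials n t)
      ≡⟨ cong₂ _+_ (length-monomials n (suc t)) (length-monomials n t) ⟩
    suc (∑[ i < t ] (n C suc i) + ∑[ i < t ] (n C i))
      ≡⟨ cong suc (ℕ.+-comm (∑[ i < t ] (n C suc i)) _) ⟩
    suc (∑[ i < t ] (n C i) + ∑[ i < t ] (n C suc i))
      ≡⟨ cong suc (∑-+ t (n C_) (λ i → n C suc i)) ⟨
    suc (∑[ i < t ] (n C i + n C suc i))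
      ≡⟨ cong suc (∑-cong t (nCk+nC[k+1]≡[n+1]C[k+1] n)) ⟩
    ∑[ i < suc t ] (suc n C i) ∎
    where open ≡-Reasoning

  private
    mask : ∀ {n N} → Vec (Subset (suc n)) N → Vec ℤ N → Vec ℤ N
    mask = Vec.zipWith (λ x z → if Vec.head x then z else 0ℤ)

    ·-x₀* : ∀ {n N} (b : Subset n → ℤ) (pts : Vec (Subset (suc n)) N) z →
            Vec.map (x₀* b) pts · z ≡ Vec.map b (Vec.map Vec.tail pts) · mask pts z
    ·-x₀* b []                  []       = refl
    ·-x₀* b ((true  ∷ x) ∷ pts) (z ∷ zs) = cong (b x *ℤ z +ℤ_) (·-x₀* b pts zs)
    ·-x₀* b ((false ∷ x) ∷ pts) (z ∷ zs) = trans (cong (0ℤ +ℤ_) (·-x₀* b pts zs))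
                                             (cong (_+ℤ Vec.map b (Vec.map Vec.tail pts) · mask pts zs) (sym (*-zeroʳ (b x))))

    ·-split : ∀ {n N} (g : Subset (suc n) → ℤ) (pts : Vec (Subset (suc n)) N) z →
              Vec.map g pts · z ≡ Vec.map (g ∘ (false ∷_)) (Vec.map Vec.tail pts) · z
                                  +ℤ Vec.map (λ x → g (true ∷ x) -ℤ g (false ∷ x)) (Vec.map Vec.tail pts) · mask pts z
    ·-split g []                  []       = refl
    ·-split g ((true  ∷ x) ∷ pts) (z ∷ zs) = trans (cong (g (true ∷ x) *ℤ z +ℤ_) (·-split g pts zs))
      (solve 5 (λ g₁ g₀ z a b → g₁ :* z :+ (a :+ b) := g₀ :* z :+ a :+ ((g₁ :- g₀) :* z :+ b)) refl (g (true ∷ x)) (g (false ∷ x)) z _ _)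
    ·-split g ((false ∷ x) ∷ pts) (z ∷ zs) = trans (cong (g (false ∷ x) *ℤ z +ℤ_) (·-split g pts zs))
      (solve 5 (λ g₁ g₀ z a b → g₀ :* z :+ (a :+ b) := g₀ :* z :+ a :+ ((g₁ :- g₀) :* con 0ℤ :+ b)) refl (g (true ∷ x)) (g (false ∷ x)) z _ _)

    ·-vanishing : ∀ {n N} {g : Subset n → ℤ} (pts : Vec (Subset n) N) z → (∀ x → g x ≡ 0ℤ) → Vec.map g pts · z ≡ 0ℤ
    ·-vanishing         []         []       g≡0 = refl
    ·-vanishing {g = g} (x ∷ pts) (z ∷ zs) g≡0 = cong₂ _+ℤ_ (cong (_*ℤ z) (g≡0 x)) (·-vanishing pts zs g≡0)

    ·-constant : ∀ {N} (g : Subset 0 → ℤ) (pts : Vec (Subset 0) N) z → Vec.map g pts · z ≡ g [] *ℤ (Vec.map (λ _ → 1ℤ) pts · z)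
    ·-constant g []         []       = sym (*-zeroʳ (g []))
    ·-constant g ([] ∷ pts) (z ∷ zs) = trans (cong (g [] *ℤ z +ℤ_) (·-constant g pts zs))
      (solve 3 (λ g z d → g :* z :+ g :* d := g :* (con 1ℤ :* z :+ d)) refl (g []) z _)

  annihilate : ∀ n t {N} (pts : Vec (Subset n) N) z → All (λ b → Vec.map b pts · z ≡ 0ℤ) (monomials n t) →
               ∀ {g} → Deg< n t g → Vec.map g pts · z ≡ 0ℤ
  annihilate n       zero    pts z _          g≡0 = ·-vanishing pts z g≡0
  annihilate zero    (suc t) pts z (⊥1 ∷ [])  {g} _ = trans (·-constant g pts z) (trans (cong (g [] *ℤ_) ⊥1) (*-zeroʳ (g [])))
  annihilate (suc n) (suc t) pts z ⊥monomials {g} (dg₀ , δg) =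
    trans (·-split g pts z) (cong₂ _+ℤ_ (annihilate n (suc t) tails z ⊥lower dg₀) (annihilate n t tails (mask pts z) ⊥upper δg))
    where
    tails = Vec.map Vec.tail pts
    lower = List.map (_∘ Vec.tail) (monomials n (suc t))
    ⊥lower : All (λ b → Vec.map b tails · z ≡ 0ℤ) (monomials n (suc t))
    ⊥lower = All.map (λ {b} ⊥b → trans (cong (_· z) (sym (Vec.map-∘ b Vec.tail pts))) ⊥b)
                     (All.map⁻ (All.++⁻ˡ lower ⊥monomials))
    ⊥upper : All (λ b → Vec.map b tails · mask pts z ≡ 0ℤ) (monomials n t)
    ⊥upper = All.map (λ {b} ⊥b → trans (sym (·-x₀* b pts z)) ⊥b) (All.map⁻ (All.++⁻ʳ lower ⊥monomials))

module IntegerKernel where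

  open import Data.Nat as ℕ using (zero; suc; _<_)
  import Data.Nat.Properties as ℕ
  open import Data.Integer using (ℤ; +_; -_; _+_; _-_; _*_; 0ℤ; 1ℤ; ∣_∣)
  open import Data.Integer.Properties
  open import Data.Integer.Divisibility.Signed
  open import Data.Nat.Primality using (prime⇒nonZero; prime⇒nonTrivial)
  open import Data.Integer.Solver using (module +-*-Solver)
  open import Data.Vec as Vec using (Vec; []; _∷_; lookup)
  import Data.Vec.Properties as Vec
  open import Data.List as List using (List; []; _∷_; length)
  import Data.List.Properties as List
  open import Data.List.Relation.Unary.All as All using (All; []; _∷_)
  import Data.List.Relation.Unary.All.Properties as All
  open import Data.Fin using (Fin; zero; suc)
  import Data.Fin.Properties as Fin
  open import Function using (_∘_)
  open import Data.Product using (∃-syntax; _×_; _,_)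
  open import Data.Sum using (_⊎_; inj₁; inj₂)
  open import Relation.Nullary using (¬_; yes; no; contradiction)
  open import Relation.Binary.PropositionalEquality
  open +-*-Solver
  open Monomials using (_·_)

  ·-zeros : ∀ {N} (r : Vec ℤ N) → r · Vec.replicate N 0ℤ ≡ 0ℤ
  ·-zeros []      = refl
  ·-zeros (x ∷ r) = cong₂ _+_ (*-zeroʳ x) (·-zeros r)

  ·-scaleʳ : ∀ {N} (r y : Vec ℤ N) c → r · Vec.map (c *_) y ≡ c * (r · y)
  ·-scaleʳ []      []       c = sym (*-zeroʳ c)
  ·-scaleʳ (x ∷ r) (y ∷ ys) c = trans (cong (λ t → x * (c * y) + t) (·-scaleʳ r ys c))
    (solve 4 (λ x c y d → x :* (c :* y) :+ c :* d := c :* (x :* y :+ d)) refl x c y (r · ys))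

  eliminate : ∀ {N} → ℤ → Vec ℤ N → Vec ℤ (suc N) → Vec ℤ N
  eliminate c r (e ∷ s) = Vec.zipWith (λ x w → c * x - e * w) s r

  ·-eliminate : ∀ {N} c e (s r y : Vec ℤ N) → eliminate c r (e ∷ s) · y ≡ c * (s · y) - e * (r · y)
  ·-eliminate c e []      []      []       = solve 2 (λ c e → con 0ℤ := c :* con 0ℤ :- e :* con 0ℤ) refl c e
  ·-eliminate c e (x ∷ s) (w ∷ r) (y ∷ ys) = trans (cong (λ t → (c * x - e * w) * y + t) (·-eliminate c e s r ys))
    (solve 7 (λ c e x w y a b → (c :* x :- e :* w) :* y :+ (c :* a :- e :* b) := c :* (x :* y :+ a) :- e :* (w :* y :+ b))
           refl c e x w y (s · ys) (r · ys))

  pivot : ∀ {N} (rows : List (Vec ℤ (suc N))) →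
          All (λ r → Vec.head r ≡ 0ℤ) rows ⊎
          ∃[ R ] ∃[ rest ] Vec.head R ≢ 0ℤ × length rows ≡ suc (length rest) ×
                           (∀ {P : Vec ℤ (suc N) → Set} → P R → All P rest → All P rows)
  pivot []       = inj₁ []
  pivot (r ∷ rs) with Vec.head r ≟ 0ℤ
  ... | no  r₀≢0 = inj₂ (r , rs , r₀≢0 , refl , _∷_)
  ... | yes r₀≡0 with pivot rs
  ...   | inj₁ heads≡0 = inj₁ (r₀≡0 ∷ heads≡0)
  ...   | inj₂ (R , rest , R₀≢0 , len , restore) =
          inj₂ (R , r ∷ rest , R₀≢0 , cong suc len , λ { pR (pr ∷ prest) → pr ∷ restore pR prest })

  kernel-vector : ∀ N (rows : List (Vec ℤ N)) → length rows < N →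
                  ∃[ z ] (∃[ j ] lookup z j ≢ 0ℤ) × All (λ r → r · z ≡ 0ℤ) rows
  kernel-vector (suc N) rows rows<N with pivot rows
  ... | inj₁ heads≡0 = 1ℤ ∷ Vec.replicate N 0ℤ , (zero , λ ()) , All.map (λ {r} → ⊥e₀ {r}) heads≡0
    where
    ⊥e₀ : ∀ {r} → Vec.head r ≡ 0ℤ → r · (1ℤ ∷ Vec.replicate N 0ℤ) ≡ 0ℤ
    ⊥e₀ {r₀ ∷ r} r₀≡0 = cong₂ _+_ (trans (cong (_* 1ℤ) r₀≡0) refl) (·-zeros r)
  ... | inj₂ (c ∷ r , rest , c≢0 , len , restore)
    with kernel-vector N (List.map (eliminate c r) rest) reduced<N
    where
    reduced<N : length (List.map (eliminate c r) rest) < N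
    reduced<N = subst (_< N) (sym (List.length-map (eliminate c r) rest)) (ℕ.≤-pred (subst (_< suc N) len rows<N))
  ...   | y , (j , yj≢0) , ⊥reduced = z , (suc j , zj≢0) , restore ⊥pivot (All.map (λ {row} → ⊥row {row}) (All.map⁻ ⊥reduced))
    where
    z = - (r · y) ∷ Vec.map (c *_) y
    ⊥pivot : (c ∷ r) · z ≡ 0ℤ
    ⊥pivot = trans (cong (λ t → c * - (r · y) + t) (·-scaleʳ r y c))
                   (solve 2 (λ c d → c :* (:- d) :+ c :* d := con 0ℤ) refl c (r · y))
    ⊥row : ∀ {row} → eliminate c r row · y ≡ 0ℤ → row · z ≡ 0ℤ
    ⊥row {e ∷ s} ⊥ = begin
      e * - (r · y) + s · Vec.map (c *_) y ≡⟨ cong (λ t → e * - (r · y) + t) (·-scaleʳ s y c) ⟩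
      e * - (r · y) + c * (s · y)          ≡⟨ solve 4 (λ e d c s → e :* (:- d) :+ c :* s := c :* s :- e :* d) refl e (r · y) c (s · y) ⟩
      c * (s · y) - e * (r · y)            ≡⟨ ·-eliminate c e s r y ⟨
      eliminate c r (e ∷ s) · y            ≡⟨ ⊥ ⟩
      0ℤ                                   ∎
      where open ≡-Reasoning
    zj≢0 : lookup z (suc j) ≢ 0ℤ
    zj≢0 cyj≡0 with i*j≡0⇒i≡0∨j≡0 c (trans (sym (Vec.lookup-map j (c *_) y)) cyj≡0)
    ... | inj₁ c≡0  = c≢0 c≡0
    ... | inj₂ yj≡0 = yj≢0 yj≡0

  ·-∣ : ∀ {N} M (w z : Vec ℤ N) → (∀ j → M ∣ lookup w j) → M ∣ w · z
  ·-∣ M []      []      _   = divides 0ℤ (sym (*-zeroˡ M))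
  ·-∣ M (a ∷ w) (b ∷ z) M∣w = ∣m∣n⇒∣m+n (∣m⇒∣m*n b (M∣w zero)) (·-∣ M w z (M∣w ∘ suc))

  ∣·⇒∣-term : ∀ {N} M (w z : Vec ℤ N) j₀ → (∀ j → j ≢ j₀ → M ∣ lookup w j) → M ∣ w · z →
              M ∣ lookup w j₀ * lookup z j₀
  ∣·⇒∣-term M (a ∷ w) (b ∷ z) zero     M∣w M∣w·z = ∣m+n∣n⇒∣m M∣w·z (·-∣ M w z (λ j → M∣w (suc j) λ ()))
  ∣·⇒∣-term M (a ∷ w) (b ∷ z) (suc j₀) M∣w M∣w·z =
    ∣·⇒∣-term M w z j₀ (λ j j≢j₀ → M∣w (suc j) (j≢j₀ ∘ Fin.suc-injective)) (∣m+n∣m⇒∣n M∣w·z (∣m⇒∣m*n b (M∣w zero λ ())))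

  module _ {p} (prime : Prime p) where

    private instance _ = prime⇒nonZero prime

    ·-scale⁻¹ : ∀ {N} (r z w : Vec ℤ N) → (∀ i → lookup z i ≡ lookup w i * + p) → r · z ≡ (r · w) * + p
    ·-scale⁻¹ []      []      []      _  = sym (*-zeroˡ (+ p))
    ·-scale⁻¹ (x ∷ r) (y ∷ z) (u ∷ w) z≡ = trans (cong₂ (λ a b → x * a + b) (z≡ zero) (·-scale⁻¹ r z w (z≡ ∘ suc)))
      (solve 4 (λ x u p d → x :* (u :* p) :+ d :* p := (x :* u :+ d) :* p) refl x u (+ p) (r · w))

    p-primitive-kernel-vector : ∀ N (rows : List (Vec ℤ N)) → length rows < N →
                                ∃[ z ] (∃[ j ] ¬ + p ∣ lookup z j) × All (λ r → r · z ≡ 0ℤ) rows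
    p-primitive-kernel-vector N rows rows<N with kernel-vector N rows rows<N
    ... | z , (j , zj≢0) , ⊥z = divide-out ∣ lookup z j ∣ z zj≢0 ℕ.≤-refl ⊥z
      where
      divide-out : ∀ fuel z → lookup z j ≢ 0ℤ → ∣ lookup z j ∣ ℕ.≤ fuel → All (λ r → r · z ≡ 0ℤ) rows →
                   ∃[ z′ ] (∃[ j ] ¬ + p ∣ lookup z′ j) × All (λ r → r · z′ ≡ 0ℤ) rows
      divide-out fuel z zj≢0 zj≤fuel ⊥z with Fin.all? (λ i → + p ∣? lookup z i)
      ... | no ¬all = z , Fin.¬∀⟶∃¬ N _ (λ i → + p ∣? lookup z i) ¬all , ⊥z
      divide-out zero       z zj≢0 zj≤0    ⊥z | yes _ = contradiction (∣i∣≡0⇒i≡0 (ℕ.n≤0⇒n≡0 zj≤0)) zj≢0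
      divide-out (suc fuel) z zj≢0 zj≤fuel ⊥z | yes p∣z = divide-out fuel w wj≢0 wj≤fuel ⊥w
        where
        w = Vec.tabulate (λ i → quotient (p∣z i))
        z≡w*p : ∀ i → lookup z i ≡ lookup w i * + p
        z≡w*p i = trans (_∣_.equality (p∣z i)) (cong (_* + p) (sym (Vec.lookup∘tabulate _ i)))
        ⊥w : All (λ r → r · w ≡ 0ℤ) rows
        ⊥w = All.map (λ {r} ⊥ → *-cancelʳ-≡ (r · w) 0ℤ (+ p) (trans (sym (·-scale⁻¹ r z w z≡w*p)) ⊥)) ⊥z
        wj≢0 : lookup w j ≢ 0ℤ
        wj≢0 wj≡0 = zj≢0 (trans (z≡w*p j) (cong (_* + p) wj≡0))
        wj≤fuel : ∣ lookup w j ∣ ℕ.≤ fuel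
        wj≤fuel = ℕ.≤-pred (ℕ.<-≤-trans (ℕ.m<m*n ∣ lookup w j ∣ p {{∣w∣≢0}} (ℕ.nonTrivial⇒n>1 p {{prime⇒nonTrivial prime}}))
                                       (subst (ℕ._≤ suc fuel) ∣z∣≡ zj≤fuel))
          where
          ∣w∣≢0 = ℕ.≢-nonZero (wj≢0 ∘ ∣i∣≡0⇒i≡0)
          ∣z∣≡ : ∣ lookup z j ∣ ≡ ∣ lookup w j ∣ ℕ.* p
          ∣z∣≡ = trans (cong ∣_∣ (z≡w*p j)) (abs-* (lookup w j) (+ p))

module PolynomialMethod where

  open import Data.Nat as ℕ using (suc; _≤_; _<_)
  import Data.Nat.Properties as ℕ
  open import Data.Nat.Combinatorics using (_C_)
  open import Data.Integer using (ℤ; +_; _*_; ∣_∣; 0ℤ)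
  open import Data.Integer.Divisibility.Signed
  open import Data.Vec as Vec using (Vec; lookup)
  import Data.Vec.Properties as Vec
  open import Data.List as List using (List; _∷_; length)
  import Data.List.Properties as List
  open import Data.List.Membership.Propositional using (_∈_)
  open import Data.List.Membership.Propositional.Properties using (∈-lookup)
  open import Data.List.Relation.Unary.All as All using (All)
  import Data.List.Relation.Unary.All.Properties as All
  open import Data.List.Relation.Unary.AllPairs using (_∷_)
  open import Data.List.Relation.Unary.Unique.Propositional using (Unique)
  open import Data.Fin using (Fin; zero; suc)
  open import Data.Fin.Subset using (Subset)
  open import Data.Product using (∃-syntax; _×_; _,_)
  open import Data.Empty using (⊥-elim)
  open import Function using (_∘_)
  open import Relation.Nullary using (¬_; yes; no; contradiction)
  open import Relation.Binary.PropositionalEquality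
  open BigOperators using (∑)
  open CubePolynomials using (Deg<)
  open Monomials using (_·_; monomials; length-monomials; annihilate)
  open IntegerKernel using (p-primitive-kernel-vector; ∣·⇒∣-term)

  lookup-injective : ∀ {A : Set} {xs : List A} → Unique xs → ∀ i j → List.lookup xs i ≡ List.lookup xs j → i ≡ j
  lookup-injective {xs = x ∷ xs} (_     ∷ _)    zero    zero    _ = refl
  lookup-injective {xs = x ∷ xs} (x∉xs ∷ _)    zero    (suc j) x≡ = contradiction x≡ (All.lookup x∉xs (∈-lookup j))
  lookup-injective {xs = x ∷ xs} (x∉xs ∷ _)    (suc i) zero    ≡x = contradiction (sym ≡x) (All.lookup x∉xs (∈-lookup i))
  lookup-injective {xs = x ∷ xs} (_     ∷ uniq) (suc i) (suc j) eq = cong suc (lookup-injective uniq i j eq)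

  -- The f A are linearly independent modulo p^r, so there are at most as many as monomials of degree < t.
  |F|≤#monomials : ∀ {p} → Prime p → ∀ n t r (F : List (Subset n)) → Unique F → (f : Subset n → Subset n → ℤ) →
                   (∀ A → A ∈ F → Deg< n t (f A)) →
                   (∀ A B → A ∈ F → B ∈ F → A ≢ B → + (p ℕ.^ r) ∣ f A B) →
                   (∀ A → A ∈ F → ¬ + (p ℕ.^ r) ∣ f A A) →
                   length F ≤ ∑[ i < t ] (n C i)
  |F|≤#monomials {p} prime n t r F uniq f deg off-diagonal diagonal with length F ℕ.≤? ∑[ i < t ] (n C i)
  ... | yes |F|≤ = |F|≤
  ... | no  |F|≰ = ⊥-elim (no-kernel-vector (p-primitive-kernel-vector prime (length F) rows #rows<|F|))
    where
    pts = Vec.tabulate (List.lookup F)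
    rows = List.map (λ b → Vec.map b pts) (monomials n t)
    #rows<|F| : length rows < length F
    #rows<|F| = subst (_< length F) (sym (trans (List.length-map _ (monomials n t)) (length-monomials n t))) (ℕ.≰⇒> |F|≰)
    no-kernel-vector : ¬ (∃[ z ] (∃[ j ] ¬ + p ∣ lookup z j) × All (λ r → r · z ≡ 0ℤ) rows)
    no-kernel-vector (z , (j₀ , p∤zj₀) , ⊥rows) = diagonal A A∈F p^r∣fAA
      where
      A = List.lookup F j₀
      A∈F = ∈-lookup j₀
      fA[pts]≡ : ∀ j → lookup (Vec.map (f A) pts) j ≡ f A (List.lookup F j)
      fA[pts]≡ j = trans (Vec.lookup-map j (f A) pts) (cong (f A) (Vec.lookup∘tabulate _ j))
      p^r∣fA[pts] : ∀ j → j ≢ j₀ → + (p ℕ.^ r) ∣ lookup (Vec.map (f A) pts) j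
      p^r∣fA[pts] j j≢j₀ = subst (+ (p ℕ.^ r) ∣_) (sym (fA[pts]≡ j))
        (off-diagonal A _ A∈F (∈-lookup j) λ A≡ → j≢j₀ (sym (lookup-injective uniq j₀ j A≡)))
      p^r∣fAA*zj₀ : + (p ℕ.^ r) ∣ f A A * lookup z j₀
      p^r∣fAA*zj₀ = subst (λ x → + (p ℕ.^ r) ∣ x * lookup z j₀) (fA[pts]≡ j₀)
        (∣·⇒∣-term (+ (p ℕ.^ r)) (Vec.map (f A) pts) z j₀ p^r∣fA[pts] (subst (+ (p ℕ.^ r) ∣_) (sym (annihilate n t pts z (All.map⁻ ⊥rows) (deg A A∈F))) (divides 0ℤ refl)))
      p^r∣fAA : + (p ℕ.^ r) ∣ f A A
      p^r∣fAA = ModPrimePowers.p^n∣x*y⇒p^n∣x prime r (f A A) (p∤zj₀ ∘ ∣ᵤ⇒∣) p^r∣fAA*zj₀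

module DifferencingSperner {p} (prime : Prime p) (k a d : ℕ) .{{_ : NonZero a}} .{{_ : NonZero d}} where

  open import Data.Nat as ℕ using (zero; suc; _≤_; _<_; _∸_; _⊔_; _!)
  import Data.Nat.Properties as ℕ
  import Data.Nat.Divisibility as ℕ
  open import Data.Nat.DivMod as ℕ using (_%_; _/_)
  open import Data.Nat.Combinatorics using (_C_)
  open import Data.Nat.Primality using (prime⇒nonZero)
  open import Data.Integer using (ℤ; +_; -_; _+_; _-_; _*_) renaming (∣_∣ to ∣_∣ℤ)
  open import Data.Integer.Properties
  open import Data.Integer.Divisibility.Signed
  open import Data.Integer.Solver using (module +-*-Solver)
  open import Data.Bool using (true; false)
  open import Data.Vec using ([]; _∷_)
  open import Data.Fin.Subset using (Subset; _─_; ∣_∣)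
  open import Data.List using (List; length)
  open import Data.List.Membership.Propositional using (_∈_)
  open import Data.List.Relation.Unary.Unique.Propositional using (Unique)
  open import Data.Product using (∃-syntax; _×_; _,_)
  open import Relation.Nullary using (¬_)
  open import Relation.Binary.PropositionalEquality
  open +-*-Solver
  open BigOperators using (∑; ∏)
  open IntegerProducts using (∏ℤ; ∣∏ℤ∣)
  open ArithmeticProgression prime k a d using (ℓ; p^[1+∑v]∣∏[m-ℓj])

  private instance
    _ = prime⇒nonZero prime
    _ = ℕ.m^n≢0 p k

  m%q≡n%q⇒q∣m-n : ∀ q {m n} .{{_ : NonZero q}} → m % q ≡ n % q → + q ∣ + m - + n
  m%q≡n%q⇒q∣m-n q {m} {n} m%q≡n%q = divides (+ (m / q) - + (n / q)) (begin
    + m - + n                                                     ≡⟨ cong₂ (λ x y → + x - + y) (ℕ.m≡m%n+[m/n]*n m q) (ℕ.m≡m%n+[m/n]*n n q) ⟩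
    + (m % q ℕ.+ m / q ℕ.* q) - + (n % q ℕ.+ n / q ℕ.* q)         ≡⟨ cong (λ r → + (m % q ℕ.+ m / q ℕ.* q) - + (r ℕ.+ n / q ℕ.* q)) (sym m%q≡n%q) ⟩
    + (m % q ℕ.+ m / q ℕ.* q) - + (m % q ℕ.+ n / q ℕ.* q)         ≡⟨ cong₂ _-_ (trans (pos-+ (m % q) _) (cong (λ x → + (m % q) + x) (pos-* (m / q) q)))
                                                                               (trans (pos-+ (m % q) _) (cong (λ x → + (m % q) + x) (pos-* (n / q) q))) ⟩
    (+ (m % q) + + (m / q) * + q) - (+ (m % q) + + (n / q) * + q) ≡⟨ solve 4 (λ r x y q → (r :+ x :* q) :- (r :+ y :* q) := (x :- y) :* q) refl (+ (m % q)) (+ (m / q)) (+ (n / q)) (+ q) ⟩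
    (+ (m / q) - + (n / q)) * + q                                 ∎)
    where open ≡-Reasoning

  ∣A─A∣≡0 : ∀ {n} (A : Subset n) → ∣ A ─ A ∣ ≡ 0
  ∣A─A∣≡0 []          = refl
  ∣A─A∣≡0 (true  ∷ A) = ∣A─A∣≡0 A
  ∣A─A∣≡0 (false ∷ A) = ∣A─A∣≡0 A

  f : ∀ {n} → ℕ → Subset n → Subset n → ℤ
  f s A x = ∏ℤ[ j < s ] (+ ∣ A ─ x ∣ - + ℓ j)

  ∣fAA∣≡∏ℓ : ∀ {n} s (A : Subset n) → ∣ f s A A ∣ℤ ≡ ∏[ j < s ] ℓ j
  ∣fAA∣≡∏ℓ s A = trans (∣∏ℤ∣ s _) (BigOperators.∏-cong s λ j →
    trans (cong (λ c → ∣ + c - + ℓ j ∣ℤ) (∣A─A∣≡0 A)) (trans (cong ∣_∣ℤ (+-identityˡ (- + ℓ j))) (∣-i∣≡∣i∣ (+ ℓ j))))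

  differencing-sperner-bound :
    ∀ s n → ℓ (s ∸ 1) < p ℕ.^ k → (F : List (Subset n)) → Unique F →
    (∀ A B → A ∈ F → B ∈ F → A ≢ B → ∃[ i ] i < s × ∣ A ─ B ∣ % p ℕ.^ k ≡ ℓ i % p ℕ.^ k) →
    ∑[ j < s ] v p (ℓ j) < ((s ∸ 1) ℕ.* v p d ℕ.+ k) ⊔ (s ℕ.* v p d ℕ.+ v p (s !) ℕ.+ 1) →
    length F ≤ ∑[ i < suc s ] (n C i)
  differencing-sperner-bound s n ℓ<q F uniq differencing V<X⊔Y =
    PolynomialMethod.|F|≤#monomials prime n (suc s) (suc V) F uniq (f s)
      (λ A _ → CubePolynomials.Deg<-∏[∣A─x∣-ℓj] n s A ℓ) off-diagonal diagonal
    where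
    V = ∑[ j < s ] v p (ℓ j)
    off-diagonal : ∀ A B → A ∈ F → B ∈ F → A ≢ B → + (p ℕ.^ suc V) ∣ f s A B
    off-diagonal A B A∈F B∈F A≢B with differencing A B A∈F B∈F A≢B
    ... | i , i<s , A─B≡ℓi = p^[1+∑v]∣∏[m-ℓj] s i<s ℓ<q (m%q≡n%q⇒q∣m-n (p ℕ.^ k) A─B≡ℓi) V<X⊔Y
    diagonal : ∀ A → A ∈ F → ¬ + (p ℕ.^ suc V) ∣ f s A A
    diagonal A _ p^∣fAA = Valuation.p^[1+∑v]∤∏ prime s ℓ ℓ≢0
                            (subst (p ℕ.^ suc V ℕ.∣_) (∣fAA∣≡∏ℓ s A) (∣⇒∣ᵤ p^∣fAA))
      where
      ℓ≢0 : ∀ j → NonZero (ℓ j)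
      ℓ≢0 j = ℕ.>-nonZero (ℕ.<-≤-trans (ℕ.>-nonZero⁻¹ a) (ℕ.m≤m+n a (j ℕ.* d)))

open import Data.Nat using (ℕ; suc; _+_; _*_; _∸_; _^_; _≤_; _<_; _⊔_; _%_; _!; NonZero; >-nonZero)
open import Data.Nat.Primality using (Prime)
open import Data.Nat.Combinatorics using (_C_)
open import Data.Fin.Subset using (Subset; _─_; ∣_∣)
open import Data.List using (List; length; map; upTo)
open import Data.Nat.ListAction using (sum)
open import Data.List.Membership.Propositional using (_∈_)
open import Data.List.Relation.Unary.Unique.Propositional using (Unique)
open import Data.Product using (Σ; _×_)
open import Relation.Binary.PropositionalEquality using (_≡_; _≢_; subst; sym)

theorem1p6 : (p k : ℕ) → Prime p → .{{_ : NonZero (p ^ k)}} → (a d s n : ℕ) → 1 ≤ a → 1 ≤ d → 1 ≤ s →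
    a + (s ∸ 1) * d < p ^ k →
    (F : List (Subset n)) → Unique F →
    (∀ A B → A ∈ F → B ∈ F → A ≢ B →
      Σ ℕ (λ i → i < s × ∣ A ─ B ∣ % (p ^ k) ≡ (a + i * d) % (p ^ k))) →
    sum (map (λ i → v p (a + i * d)) (upTo s))
      < ((s ∸ 1) * v p d + k) ⊔ (s * v p d + v p (s !) + 1) →
    length F ≤ sum (map (λ i → n C i) (upTo (suc s)))
theorem1p6 p k prime a d s n 1≤a 1≤d _ ℓ<q F uniq differencing V<X⊔Y =
  subst (length F ≤_) (sym (BigOperators.sum-map-upTo (suc s) (n C_)))
    (differencing-sperner-bound s n ℓ<q F uniq differencing (subst (_< _) (BigOperators.sum-map-upTo s _) V<X⊔Y))
  where
  instance
    _ = >-nonZero 1≤a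
    _ = >-nonZero 1≤d
  open DifferencingSperner prime k a d
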